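{- Let $\mathbb{F}_2$ be the field with two elements. (a) Let $Q=x^{2m}+\sum_{j=0}^{2m-1}\alpha_j x^j\in\mathbb{F}_2[x]$ be irreducible of even degree $l=2m$. If $\alpha_{2m-1}=1$, then both polynomials $Q(x+x^2)$ and $Q(1+x+x^2)$ are irreducible in $\mathbb{F}_2[x]$ of degree $2l$. If $\alpha_{2m-1}=0$, then each of the polynomials $Q(x+x^2)$ and $Q(1+x+x^2)$ factors in $\mathbb{F}_2[x]$ as a product of two irreducible polynomials of degree $l$ having the same trace. (b) Let $Q=x^{2m+1}+\sum_{j=0}^{2m}\alpha_j x^j\in\mathbb{F}_2[x]$ be irreducible of odd degree $l=2m+1$. Then the polynomial $Q(1+\alpha_{2m}+x+x^2)\in\mathbb{F}_2[x]$ is irreducible of degree $2l$, and the polynomial $Q(\alpha_{2m}+x+x^2)\in\mathbb{F}_2[x]$ factors as a product of two irreducible polynomials of degree $l$ having different traces.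
   Context: For $p$ prime and an irreducible polynomial $F=\sum_{j=0}^d\beta_jx^j\in\mathbb{F}_p[x]$ of degree $d$ dividing $l$, the relative trace is $\mathrm{tr}_l(F)=\sum_{k=0}^{l-1}\rho^{p^k}=-\frac{l}{d}\frac{\beta_{d-1}}{\beta_d}\in\mathbb{F}_p$, where $\rho\in\mathbb{F}_{p^l}$ is a root of $F$. In particular the trace of a monic irreducible polynomial of degree $l$ over $\mathbb{F}_2$ is its coefficient of $x^{l-1}$; "trace" of a degree-$l$ factor above means $\mathrm{tr}_l$ of it. $Q(R)$ denotes the composition $Q\circ R$. -}

module Defs where

open import Data.Bool using (Bool; true; false; not; _xor_; if_then_else_)
open import Data.List using (List; []; _∷_)
open import Data.Nat using (ℕ; zero; suc; _<_; _*_; _+_; _∸_)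
open import Data.Product using (Σ; _×_; ∃; ∃-syntax)
open import Data.Sum using (_⊎_)
open import Relation.Binary.PropositionalEquality using (_≡_; _≢_)
open import Relation.Nullary using (¬_)

-- Polynomials over 𝔽₂ = Bool (false = 0, true = 1, addition = xor, mult = ∧),
-- represented by coefficient lists, lowest degree first.
-- Trailing zeros are allowed; equality of polynomials is _≈ₚ_ below.
Poly : Set
Poly = List Bool

coeff : Poly → ℕ → Bool
coeff []       _       = false
coeff (a ∷ p)  zero    = a
coeff (a ∷ p)  (suc i) = coeff p i

_≈ₚ_ : Poly → Poly → Set
P ≈ₚ R = ∀ i → coeff P i ≡ coeff R i

0ₚ : Poly
0ₚ = []

1ₚ : Poly
1ₚ = true ∷ []

_+ₚ_ : Poly → Poly → Poly
[]      +ₚ q       = q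
(a ∷ p) +ₚ []      = a ∷ p
(a ∷ p) +ₚ (b ∷ q) = (a xor b) ∷ (p +ₚ q)

_*ₚ_ : Poly → Poly → Poly
[]      *ₚ q = []
(a ∷ p) *ₚ q = (if a then q else []) +ₚ (false ∷ (p *ₚ q))

compose : Poly → Poly → Poly
compose []      R = []
compose (a ∷ Q) R = (a ∷ []) +ₚ (R *ₚ compose Q R)

-- P has degree d (over 𝔽₂ such a P is automatically monic)
HasDegree : Poly → ℕ → Set
HasDegree P d = (coeff P d ≡ true) × (∀ i → d < i → coeff P i ≡ false)

IsUnit : Poly → Set
IsUnit A = ∃[ B ] ((A *ₚ B) ≈ₚ 1ₚ)

Irreducible : Poly → Set
Irreducible P =
  (¬ (P ≈ₚ 0ₚ)) × (¬ IsUnit P) ×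
  (∀ A B → P ≈ₚ (A *ₚ B) → IsUnit A ⊎ IsUnit B)

-- relative trace tr_l(F) of a (monic) polynomial F of degree l over 𝔽₂:
-- tr_l(F) = -(l/l) β_{l-1}/β_l = coefficient of x^{l-1}
trace : ℕ → Poly → Bool
trace l F = coeff F (l ∸ 1)

x+x² : Poly
x+x² = false ∷ true ∷ true ∷ []

1+x+x² : Poly
1+x+x² = true ∷ true ∷ true ∷ []

c+x+x² : Bool → Poly
c+x+x² c = c ∷ true ∷ true ∷ []

FactorsTwo : ℕ → Poly → (Bool → Bool → Set) → Set
FactorsTwo l P Rel =
  ∃[ F ] ∃[ G ] (Irreducible F × Irreducible G ×
    HasDegree F l × HasDegree G l × (P ≈ₚ (F *ₚ G)) ×
    Rel (trace l F) (trace l G))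

-- Let K = 𝔽₂[x]/(Q), of degree l, and let θ ∈ K be the class of x + c. Every non-unit factor A of
-- P = Q(c + x + x²) receives K through S ↦ S(c + x + x²) mod A, which is injective because K is a
-- field; so deg A ≥ l, and if deg A = l the map is onto and the preimage Y of x solves Y² + Y = θ.
-- Such a Y exists exactly when Tr θ = 0, where Tr θ = tr(Q) + c l: the map V ↦ V² + V + V₀ b with
-- Tr b = 1 is additive and injective on K, hence onto, and its trace is V₀. If Tr θ = 1, P is thus
-- irreducible. If Tr θ = 0, P divides A (A + 1) for A = x + Y(c + x + x²) but neither factor, so
-- gcd(P, A) splits P into two factors, both of degree l and irreducible by the degree bound; the sum
-- of their traces is the coefficient l of x^(2l-1) in P. An element b with Tr b = 1 comes from
-- Euler's formula Tr S = τ(S Q'), τ the coefficient of x^(l-1), as Q' ≠ 0 mod Q for Q not a square.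

module Submission where

open import Defs

open import Algebra.Bundles using (CommutativeRing)
import Algebra.Consequences.Setoid as Consequences
open import Algebra.Consequences.Propositional using (comm∧assoc⇒middleFour)
import Algebra.Properties.CommutativeMagma.Divisibility
import Algebra.Properties.Semiring.Divisibility
open import Data.Bool using (Bool; true; false; not; _xor_; _∧_; if_then_else_)
open import Data.Bool.Properties
  using (xor-comm; xor-assoc; xor-identityʳ; xor-same; xor-inverseʳ; not-distribˡ-xor; not-involutive;
         ∧-comm; ∧-idem; ∧-identityʳ; ∧-zeroʳ; ∧-distribˡ-xor; T-≡)
open import Data.Empty using (⊥; ⊥-elim)
open import Data.Fin using (Fin; zero; suc; combine; remQuot; punchOut)
open import Data.Fin.Properties
  using (2↔Bool; remQuot-combine; combine-remQuot; punchOut-injective; injective⇒≤; any?; _≟_)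
open import Data.List using ([]; _∷_; length; take; drop)
open import Data.Maybe using (nothing)
open import Data.Nat using (ℕ; zero; suc; _+_; _*_; _∸_; _^_; _≤_; _<_; z≤n; s≤s; _≡ᵇ_)
open import Data.Nat.Properties
  using (≤-refl; ≤-trans; <⇒≤; ≤-pred; n≤1+n; m≤n+m; <-cmp; <-irrefl; <⇒≢; <⇒≱; ≮⇒≥; ≰⇒>; 1+n≰n; 1+n≢n;
         m≤n⇒m<n∨m≡n; m+n≡0⇒n≡0; m<m+n; +-monoʳ-<; +-monoˡ-<; +-mono-<-≤; *-monoˡ-≤; *-suc; ^-monoʳ-<;
         m+[n∸m]≡n; m∸n+n≡m; m+n∸n≡m; ≡⇒≡ᵇ)
import Data.Nat.Properties as ℕ
open import Data.Product using (_×_; _,_; proj₁; proj₂; ∃-syntax)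
open import Data.Sum using (_⊎_; inj₁; inj₂; [_,_]′)
open import Data.Vec using (Vec; []; _∷_; toList)
import Data.Vec.Properties as Vec
open import Function using (Inverse; Equivalence; id; _∘_)
open import Function.Definitions using (Injective)
open import Level using (0ℓ)
open import Relation.Binary.Bundles using (Setoid)
open import Relation.Binary.Definitions using (tri<; tri≈; tri>)
open import Relation.Binary.PropositionalEquality
  using (_≡_; _≢_; refl; sym; trans; cong; cong₂; subst; module ≡-Reasoning)
import Relation.Binary.Reasoning.Setoid
open import Relation.Binary.Structures using (IsEquivalence)
open import Relation.Nullary using (¬_; yes; no; contradiction)
open import Tactic.RingSolver using (solve-∀)
open import Tactic.RingSolver.Core.AlmostCommutativeRing using (AlmostCommutativeRing; fromCommutativeRing)

open Inverse 2↔Bool using ()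
  renaming ( to to bit⇒Bool; from to Bool⇒bit
           ; strictlyInverseˡ to bit⇒Bool∘Bool⇒bit; strictlyInverseʳ to Bool⇒bit∘bit⇒Bool)

-- The ring 𝔽₂[x]

-- A record version of _≈ₚ_, so that both polynomials can be inferred from a proof.
infix 4 _≋_
record _≋_ (P R : Poly) : Set where
  constructor mk≋
  field coeff-≡ : ∀ i → coeff P i ≡ coeff R i
open _≋_

≋-refl : ∀ {P} → P ≋ P
≋-refl = mk≋ λ _ → refl

≋-sym : ∀ {P R} → P ≋ R → R ≋ P
≋-sym e = mk≋ λ i → sym (coeff-≡ e i)

≋-trans : ∀ {P R S} → P ≋ R → R ≋ S → P ≋ S
≋-trans e f = mk≋ λ i → trans (coeff-≡ e i) (coeff-≡ f i)

≋-isEquivalence : IsEquivalence _≋_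
≋-isEquivalence = record { refl = ≋-refl ; sym = ≋-sym ; trans = ≋-trans }

≋-setoid : Setoid 0ℓ 0ℓ
≋-setoid = record { isEquivalence = ≋-isEquivalence }

module ≋-Reasoning = Relation.Binary.Reasoning.Setoid ≋-setoid

∷-cong : ∀ {a b P R} → a ≡ b → P ≋ R → (a ∷ P) ≋ (b ∷ R)
∷-cong a≡b e = mk≋ λ { zero → a≡b ; (suc i) → coeff-≡ e i }

∷-injective : ∀ {a b P R} → (a ∷ P) ≋ (b ∷ R) → (a ≡ b) × (P ≋ R)
∷-injective e = coeff-≡ e zero , mk≋ λ i → coeff-≡ e (suc i)

∷≋0-inversion : ∀ {a P} → (a ∷ P) ≋ 0ₚ → (a ≡ false) × (P ≋ 0ₚ)
∷≋0-inversion e = coeff-≡ e zero , mk≋ λ i → coeff-≡ e (suc i)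

false∷0≋0 : (false ∷ 0ₚ) ≋ 0ₚ
false∷0≋0 = mk≋ λ { zero → refl ; (suc _) → refl }

coeff-+ : ∀ P R i → coeff (P +ₚ R) i ≡ coeff P i xor coeff R i
coeff-+ []      R       i       = refl
coeff-+ (a ∷ P) []      i       = sym (xor-identityʳ _)
coeff-+ (a ∷ P) (b ∷ R) zero    = refl
coeff-+ (a ∷ P) (b ∷ R) (suc i) = coeff-+ P R i

+-cong : ∀ {P P' R R'} → P ≋ P' → R ≋ R' → (P +ₚ R) ≋ (P' +ₚ R')
+-cong {P} {P'} {R} {R'} e f = mk≋ λ i →
  trans (coeff-+ P R i) (trans (cong₂ _xor_ (coeff-≡ e i) (coeff-≡ f i)) (sym (coeff-+ P' R' i)))

+-comm : ∀ P R → (P +ₚ R) ≋ (R +ₚ P)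
+-comm P R = mk≋ λ i →
  trans (coeff-+ P R i) (trans (xor-comm (coeff P i) (coeff R i)) (sym (coeff-+ R P i)))

+-assoc : ∀ P R S → ((P +ₚ R) +ₚ S) ≋ (P +ₚ (R +ₚ S))
+-assoc P R S = mk≋ λ i → begin
  coeff ((P +ₚ R) +ₚ S) i
    ≡⟨ trans (coeff-+ (P +ₚ R) S i) (cong (_xor coeff S i) (coeff-+ P R i)) ⟩
  (coeff P i xor coeff R i) xor coeff S i
    ≡⟨ xor-assoc (coeff P i) (coeff R i) (coeff S i) ⟩
  coeff P i xor (coeff R i xor coeff S i)
    ≡⟨ trans (coeff-+ P (R +ₚ S) i) (cong (coeff P i xor_) (coeff-+ R S i)) ⟨
  coeff (P +ₚ (R +ₚ S)) i  ∎
  where open ≡-Reasoning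

+-identityʳ : ∀ P → (P +ₚ 0ₚ) ≋ P
+-identityʳ P = mk≋ λ i → trans (coeff-+ P [] i) (xor-identityʳ _)

+-self : ∀ P → (P +ₚ P) ≋ 0ₚ
+-self P = mk≋ λ i → trans (coeff-+ P P i) (xor-same (coeff P i))

-- The ring solver does not know that 1 + 1 = 0: identities that need it are solved with an explicit
-- doubled summand, which drop-double then removes.
drop-double : ∀ {P R} S → P ≋ (R +ₚ (S +ₚ S)) → P ≋ R
drop-double {R = R} S e = ≋-trans e (≋-trans (+-cong ≋-refl (+-self S)) (+-identityʳ R))

+-middleFour : ∀ P R S T → ((P +ₚ R) +ₚ (S +ₚ T)) ≋ ((P +ₚ S) +ₚ (R +ₚ T))
+-middleFour = Consequences.comm∧assoc⇒middleFour ≋-setoid +-cong +-comm +-assoc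

+-leftComm : ∀ P R S → (P +ₚ (R +ₚ S)) ≋ (R +ₚ (P +ₚ S))
+-leftComm P R S = ≋-trans (≋-sym (+-assoc P R S))
  (≋-trans (+-cong (+-comm P R) ≋-refl) (+-assoc R P S))

scale : Bool → Poly → Poly
scale a P = if a then P else 0ₚ

coeff-scale : ∀ a P i → coeff (scale a P) i ≡ a ∧ coeff P i
coeff-scale true  P i = refl
coeff-scale false P i = refl

scale-∷ : ∀ a b P → scale a (b ∷ P) ≋ ((a ∧ b) ∷ scale a P)
scale-∷ true  b P = ≋-refl
scale-∷ false b P = ≋-sym false∷0≋0

scale-∷0 : ∀ a P → scale a (false ∷ P) ≋ (false ∷ scale a P)
scale-∷0 true  P = ≋-refl
scale-∷0 false P = ≋-sym false∷0≋0

scale-congˡ : ∀ a {P R} → P ≋ R → scale a P ≋ scale a R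
scale-congˡ true  e = e
scale-congˡ false e = ≋-refl

scale-congʳ : ∀ {a b} P → a ≡ b → scale a P ≋ scale b P
scale-congʳ P refl = ≋-refl

scale-xor : ∀ a b P → scale (a xor b) P ≋ (scale a P +ₚ scale b P)
scale-xor true  true  P = ≋-sym (+-self P)
scale-xor true  false P = ≋-sym (+-identityʳ P)
scale-xor false b     P = ≋-refl

*-zeroʳ : ∀ P → (P *ₚ 0ₚ) ≋ 0ₚ
*-zeroʳ []          = ≋-refl
*-zeroʳ (true ∷ P)  = ≋-trans (∷-cong refl (*-zeroʳ P)) false∷0≋0
*-zeroʳ (false ∷ P) = ≋-trans (∷-cong refl (*-zeroʳ P)) false∷0≋0

≋0⇒*≋0 : ∀ {P} R → P ≋ 0ₚ → (P *ₚ R) ≋ 0ₚ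
≋0⇒*≋0 {[]}    R e = ≋-refl
≋0⇒*≋0 {a ∷ P} R e with ∷≋0-inversion e
... | refl , P≋0 = ≋-trans (∷-cong refl (≋0⇒*≋0 R P≋0)) false∷0≋0

*-congʳ : ∀ {P P'} R → P ≋ P' → (P *ₚ R) ≋ (P' *ₚ R)
*-congʳ {[]}    {[]}     R e = ≋-refl
*-congʳ {[]}    {b ∷ P'} R e = ≋-sym (≋0⇒*≋0 R (≋-sym e))
*-congʳ {a ∷ P} {[]}     R e = ≋0⇒*≋0 R e
*-congʳ {a ∷ P} {b ∷ P'} R e with ∷-injective e
... | refl , P≋P' = +-cong ≋-refl (∷-cong refl (*-congʳ R P≋P'))

*-congˡ : ∀ P {R R'} → R ≋ R' → (P *ₚ R) ≋ (P *ₚ R')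
*-congˡ []      e = ≋-refl
*-congˡ (a ∷ P) e = +-cong (scale-congˡ a e) (∷-cong refl (*-congˡ P e))

*-cong : ∀ {P P' R R'} → P ≋ P' → R ≋ R' → (P *ₚ R) ≋ (P' *ₚ R')
*-cong {P' = P'} {R = R} e f = ≋-trans (*-congʳ R e) (*-congˡ P' f)

*-∷ʳ : ∀ P b R → (P *ₚ (b ∷ R)) ≋ (scale b P +ₚ (false ∷ (P *ₚ R)))
*-∷ʳ []      true  R = ≋-sym false∷0≋0
*-∷ʳ []      false R = ≋-sym false∷0≋0
*-∷ʳ (a ∷ P) b R = begin
  scale a (b ∷ R) +ₚ (false ∷ (P *ₚ (b ∷ R)))
    ≈⟨ +-cong (scale-∷ a b R) (∷-cong refl (*-∷ʳ P b R)) ⟩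
  ((a ∧ b) xor false) ∷ (scale a R +ₚ (scale b P +ₚ (false ∷ (P *ₚ R))))
    ≈⟨ ∷-cong (cong (_xor false) (∧-comm a b)) (+-leftComm (scale a R) (scale b P) _) ⟩
  ((b ∧ a) xor false) ∷ (scale b P +ₚ (scale a R +ₚ (false ∷ (P *ₚ R))))
    ≈⟨ +-cong (≋-sym (scale-∷ b a P)) ≋-refl ⟩
  scale b (a ∷ P) +ₚ (false ∷ (scale a R +ₚ (false ∷ (P *ₚ R))))  ∎
  where open ≋-Reasoning

*-comm : ∀ P R → (P *ₚ R) ≋ (R *ₚ P)
*-comm []      R = ≋-sym (*-zeroʳ R)
*-comm (a ∷ P) R = ≋-trans (+-cong ≋-refl (∷-cong refl (*-comm P R))) (≋-sym (*-∷ʳ R a P))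

*-distribʳ : ∀ R P P' → ((P +ₚ P') *ₚ R) ≋ ((P *ₚ R) +ₚ (P' *ₚ R))
*-distribʳ R []      P'       = ≋-refl
*-distribʳ R (a ∷ P) []       = ≋-sym (+-identityʳ _)
*-distribʳ R (a ∷ P) (b ∷ P') =
  ≋-trans (+-cong (scale-xor a b R) (∷-cong refl (*-distribʳ R P P')))
          (+-middleFour (scale a R) (scale b R) (false ∷ (P *ₚ R)) (false ∷ (P' *ₚ R)))

*-assoc : ∀ P R S → ((P *ₚ R) *ₚ S) ≋ (P *ₚ (R *ₚ S))
*-assoc []      R S = ≋-refl
*-assoc (a ∷ P) R S =
  ≋-trans (*-distribʳ S (scale a R) (false ∷ (P *ₚ R)))
          (+-cong (scale-* a) (∷-cong refl (*-assoc P R S)))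
  where
  scale-* : ∀ a → (scale a R *ₚ S) ≋ scale a (R *ₚ S)
  scale-* true  = ≋-refl
  scale-* false = ≋-refl

*-identityˡ : ∀ P → (1ₚ *ₚ P) ≋ P
*-identityˡ P = ≋-trans (+-cong ≋-refl false∷0≋0) (+-identityʳ P)

*-identityʳ : ∀ P → (P *ₚ 1ₚ) ≋ P
*-identityʳ P = ≋-trans (*-comm P 1ₚ) (*-identityˡ P)

polyRing : CommutativeRing 0ℓ 0ℓ
polyRing = record
  { Carrier = Poly ; _≈_ = _≋_ ; _+_ = _+ₚ_ ; _*_ = _*ₚ_ ; -_ = id ; 0# = 0ₚ ; 1# = 1ₚ
  ; isCommutativeRing = record
    { isRing = record
      { +-isAbelianGroup = record
        { isGroup = record
          { isMonoid = record
            { isSemigroup = record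
              { isMagma = record { isEquivalence = ≋-isEquivalence ; ∙-cong = +-cong }
              ; assoc = +-assoc }
            ; identity = (λ _ → ≋-refl) , +-identityʳ }
          ; inverse = +-self , +-self
          ; ⁻¹-cong = id }
        ; comm = +-comm }
      ; *-cong = *-cong
      ; *-assoc = *-assoc
      ; *-identity = *-identityˡ , *-identityʳ
      ; distrib = Consequences.comm∧distrʳ⇒distr ≋-setoid +-cong *-comm *-distribʳ }
    ; *-comm = *-comm } }

*-distribˡ : ∀ R P P' → (R *ₚ (P +ₚ P')) ≋ ((R *ₚ P) +ₚ (R *ₚ P'))
*-distribˡ = CommutativeRing.distribˡ polyRing

almostPolyRing : AlmostCommutativeRing 0ℓ 0ℓ
almostPolyRing = fromCommutativeRing polyRing (λ _ → nothing)

+-cancel-middle : ∀ A B C → ((A +ₚ B) +ₚ (B +ₚ C)) ≋ (A +ₚ C)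
+-cancel-middle A B C = drop-double B (expand A B C)
  where
  expand : ∀ A B C → ((A +ₚ B) +ₚ (B +ₚ C)) ≋ ((A +ₚ C) +ₚ (B +ₚ B))
  expand = solve-∀ almostPolyRing

+-move : ∀ {X Y Z} → (X +ₚ Y) ≋ Z → X ≋ (Z +ₚ Y)
+-move {X} {Y} {Z} e = begin
  X                ≈⟨ +-identityʳ X ⟨
  X +ₚ 0ₚ          ≈⟨ +-cong ≋-refl (+-self Y) ⟨
  X +ₚ (Y +ₚ Y)    ≈⟨ +-assoc X Y Y ⟨
  (X +ₚ Y) +ₚ Y    ≈⟨ +-cong e ≋-refl ⟩
  Z +ₚ Y           ∎
  where open ≋-Reasoning

sum≋0⇒≋ : ∀ {P R} → (P +ₚ R) ≋ 0ₚ → P ≋ R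
sum≋0⇒≋ = +-move

square-+ : ∀ P R → ((P +ₚ R) *ₚ (P +ₚ R)) ≋ ((P *ₚ P) +ₚ (R *ₚ R))
square-+ P R = drop-double (P *ₚ R) (expand P R)
  where
  expand : ∀ P R → ((P +ₚ R) *ₚ (P +ₚ R)) ≋ (((P *ₚ P) +ₚ (R *ₚ R)) +ₚ ((P *ₚ R) +ₚ (P *ₚ R)))
  expand = solve-∀ almostPolyRing

+-self-cancelˡ : ∀ P R → (P +ₚ (P +ₚ R)) ≋ R
+-self-cancelˡ P R = ≋-trans (≋-sym (+-assoc P P R)) (+-cong (+-self P) ≋-refl)

[_] : Bool → Poly
[ a ] = a ∷ []

X : Poly
X = false ∷ true ∷ []

open Algebra.Properties.Semiring.Divisibility (CommutativeRing.semiring polyRing)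
  using (_∣_; _,_; ∣ʳ-refl; ∣ʳ-trans; ∣ʳ-respʳ-≈; ∣ʳ-respˡ-≈; x∣ʳy⇒x∣ʳzy; _∣0; x∣y∧y≉0⇒x≉0)
open Algebra.Properties.CommutativeMagma.Divisibility (CommutativeRing.*-commutativeMagma polyRing)
  using (x∣xy; xy≈z⇒x|z∧y|z)

∣-+ : ∀ {M P R} → M ∣ P → M ∣ R → M ∣ (P +ₚ R)
∣-+ {M} (q , qM≋P) (r , rM≋R) = (q +ₚ r) , ≋-trans (*-distribʳ M q r) (+-cong qM≋P rM≋R)

∣-*ʳ : ∀ {M P} R → M ∣ P → M ∣ (P *ₚ R)
∣-*ʳ {P = P} R M∣P = ∣ʳ-respʳ-≈ (*-comm R P) (x∣ʳy⇒x∣ʳzy R M∣P)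

infix 4 _≡_mod_
record _≡_mod_ (A B M : Poly) : Set where
  constructor mod-intro
  field divides : M ∣ (A +ₚ B)
open _≡_mod_

module _ {M : Poly} where

  ≋⇒≡mod : ∀ {A B} → A ≋ B → A ≡ B mod M
  ≋⇒≡mod {B = B} A≋B = mod-intro (∣ʳ-respʳ-≈ (≋-trans (≋-sym (+-self B)) (+-cong (≋-sym A≋B) ≋-refl)) (M ∣0))

  ≡mod-refl : ∀ {A} → A ≡ A mod M
  ≡mod-refl = ≋⇒≡mod ≋-refl

  ≡mod-sym : ∀ {A B} → A ≡ B mod M → B ≡ A mod M
  ≡mod-sym {A} {B} (mod-intro d) = mod-intro (∣ʳ-respʳ-≈ (+-comm A B) d)

  ≡mod-trans : ∀ {A B C} → A ≡ B mod M → B ≡ C mod M → A ≡ C mod M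
  ≡mod-trans {A} {B} {C} (mod-intro d) (mod-intro e) = mod-intro (∣ʳ-respʳ-≈ (+-cancel-middle A B C) (∣-+ d e))

  ≡mod-+ : ∀ {A B C D} → A ≡ B mod M → C ≡ D mod M → (A +ₚ C) ≡ (B +ₚ D) mod M
  ≡mod-+ {A} {B} {C} {D} (mod-intro d) (mod-intro e) =
    mod-intro (∣ʳ-respʳ-≈ (+-middleFour A B C D) (∣-+ d e))

  ≡mod-* : ∀ {A B C D} → A ≡ B mod M → C ≡ D mod M → (A *ₚ C) ≡ (B *ₚ D) mod M
  ≡mod-* {A} {B} {C} {D} (mod-intro d) (mod-intro e) =
    mod-intro (∣ʳ-respʳ-≈ regroup (∣-+ (x∣ʳy⇒x∣ʳzy A e) (∣-*ʳ D d)))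
    where
    expand : ∀ A B C D → ((A *ₚ (C +ₚ D)) +ₚ ((A +ₚ B) *ₚ D)) ≋ (((A *ₚ C) +ₚ (B *ₚ D)) +ₚ ((A *ₚ D) +ₚ (A *ₚ D)))
    expand = solve-∀ almostPolyRing
    regroup : ((A *ₚ (C +ₚ D)) +ₚ ((A +ₚ B) *ₚ D)) ≋ ((A *ₚ C) +ₚ (B *ₚ D))
    regroup = drop-double (A *ₚ D) (expand A B C D)

  ≡mod-setoid : Setoid 0ℓ 0ℓ
  ≡mod-setoid = record
    { Carrier = Poly ; _≈_ = _≡_mod M
    ; isEquivalence = record { refl = ≡mod-refl ; sym = ≡mod-sym ; trans = ≡mod-trans } }

  ∣⇒≡mod0 : ∀ {A} → M ∣ A → A ≡ 0ₚ mod M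
  ∣⇒≡mod0 {A} d = mod-intro (∣ʳ-respʳ-≈ (≋-sym (+-identityʳ A)) d)

  ≡mod0⇒∣ : ∀ {A} → A ≡ 0ₚ mod M → M ∣ A
  ≡mod0⇒∣ {A} (mod-intro d) = ∣ʳ-respʳ-≈ (+-identityʳ A) d

module ≡mod-Reasoning (M : Poly) = Relation.Binary.Reasoning.Setoid (≡mod-setoid {M})

≡mod-weaken : ∀ {A M X Y} → A ∣ M → X ≡ Y mod M → X ≡ Y mod A
≡mod-weaken A∣M (mod-intro d) = mod-intro (∣ʳ-trans A∣M d)

∣-∷0 : ∀ {M P} → M ∣ P → M ∣ (false ∷ P)
∣-∷0 (q , qM≋P) = (false ∷ q) , ∷-cong refl qM≋P

∣-scale : ∀ a {M} → M ∣ scale a M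
∣-scale true  = ∣ʳ-refl
∣-scale false = _ ∣0

≡mod-∷ : ∀ {a P R M} → P ≡ R mod M → (a ∷ P) ≡ (a ∷ R) mod M
≡mod-∷ {a} (mod-intro d) = mod-intro (∣ʳ-respʳ-≈ (∷-cong (sym (xor-same a)) ≋-refl) (∣-∷0 d))

≡mod-+-divisible : ∀ {M P K} → M ∣ K → P ≡ (P +ₚ K) mod M
≡mod-+-divisible {P = P} {K} d = mod-intro (∣ʳ-respʳ-≈ (≋-sym (+-self-cancelˡ P K)) d)

≡false⇒≢true : ∀ {b} → b ≡ false → b ≢ true
≡false⇒≢true refl ()

record DegBelow (P : Poly) (n : ℕ) : Set where
  constructor degBelow
  field coeff-≥ : ∀ i → n ≤ i → coeff P i ≡ false
open DegBelow

record Deg (P : Poly) (d : ℕ) : Set where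
  constructor mkDeg
  field
    leading : coeff P d ≡ true
    below   : DegBelow P (suc d)
open Deg

HasDegree⇒Deg : ∀ {P d} → HasDegree P d → Deg P d
HasDegree⇒Deg (lead , above) = mkDeg lead (degBelow above)

Deg⇒HasDegree : ∀ {P d} → Deg P d → HasDegree P d
Deg⇒HasDegree (mkDeg lead (degBelow above)) = lead , above

DegBelow-resp-≋ : ∀ {P R n} → P ≋ R → DegBelow P n → DegBelow R n
DegBelow-resp-≋ e b = degBelow λ i n≤i → trans (sym (coeff-≡ e i)) (coeff-≥ b i n≤i)

DegBelow-mono : ∀ {P n m} → n ≤ m → DegBelow P n → DegBelow P m
DegBelow-mono n≤m b = degBelow λ i m≤i → coeff-≥ b i (≤-trans n≤m m≤i)

DegBelow-0 : ∀ {n} → DegBelow 0ₚ n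
DegBelow-0 = degBelow λ _ _ → refl

DegBelow-+ : ∀ {P R n} → DegBelow P n → DegBelow R n → DegBelow (P +ₚ R) n
DegBelow-+ {P} {R} b c = degBelow λ i n≤i →
  trans (coeff-+ P R i) (cong₂ _xor_ (coeff-≥ b i n≤i) (coeff-≥ c i n≤i))

DegBelow-scale : ∀ a {P n} → DegBelow P n → DegBelow (scale a P) n
DegBelow-scale true  b = b
DegBelow-scale false b = DegBelow-0

DegBelow-∷ : ∀ {a P n} → DegBelow P n → DegBelow (a ∷ P) (suc n)
DegBelow-∷ b = degBelow λ { (suc i) (s≤s n≤i) → coeff-≥ b i n≤i }

DegBelow-const : ∀ {a n} → DegBelow (a ∷ []) (suc n)
DegBelow-const = DegBelow-∷ DegBelow-0

DegBelow-tail : ∀ {a P n} → DegBelow (a ∷ P) (suc n) → DegBelow P n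
DegBelow-tail b = degBelow λ i n≤i → coeff-≥ b (suc i) (s≤s n≤i)

DegBelow-length : ∀ P → DegBelow P (length P)
DegBelow-length []      = DegBelow-0
DegBelow-length (a ∷ P) = DegBelow-∷ (DegBelow-length P)

DegBelow0⇒≋0 : ∀ {P} → DegBelow P 0 → P ≋ 0ₚ
DegBelow0⇒≋0 b = mk≋ λ i → coeff-≥ b i z≤n

Deg-resp-≋ : ∀ {P R d} → P ≋ R → Deg P d → Deg R d
Deg-resp-≋ e (mkDeg lead b) = mkDeg (trans (sym (coeff-≡ e _)) lead) (DegBelow-resp-≋ e b)

Deg-∷ : ∀ {a P d} → Deg P d → Deg (a ∷ P) (suc d)
Deg-∷ (mkDeg lead b) = mkDeg lead (DegBelow-∷ b)

Deg-tail : ∀ {a P d} → Deg (a ∷ P) (suc d) → Deg P d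
Deg-tail (mkDeg lead b) = mkDeg lead (DegBelow-tail b)

Deg-1 : Deg 1ₚ 0
Deg-1 = mkDeg refl DegBelow-const

Deg0⇒≋1 : ∀ {P} → Deg P 0 → P ≋ 1ₚ
Deg0⇒≋1 (mkDeg lead b) = mk≋ λ { zero → lead ; (suc i) → coeff-≥ b (suc i) (s≤s z≤n) }

Deg-+-lower : ∀ {P R n} → DegBelow P n → Deg R n → Deg (P +ₚ R) n
Deg-+-lower {P} {R} {n} b (mkDeg lead above) = mkDeg
  (trans (coeff-+ P R n) (cong₂ _xor_ (coeff-≥ b n ≤-refl) lead))
  (DegBelow-+ (DegBelow-mono (n≤1+n n) b) above)

Deg-unique : ∀ {P d e} → Deg P d → Deg P e → d ≡ e
Deg-unique {d = d} {e} hd he with <-cmp d e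
... | tri< d<e _ _ = contradiction (leading he) (≡false⇒≢true (coeff-≥ (below hd) e d<e))
... | tri≈ _ d≡e _ = d≡e
... | tri> _ _ e<d = contradiction (leading hd) (≡false⇒≢true (coeff-≥ (below he) d e<d))

Deg⇒≉0 : ∀ {P d} → Deg P d → ¬ (P ≋ 0ₚ)
Deg⇒≉0 {d = d} (mkDeg lead _) P≋0 = ≡false⇒≢true (coeff-≡ P≋0 d) lead

zero-or-Deg : ∀ P → (P ≋ 0ₚ) ⊎ (∃[ d ] Deg P d)
zero-or-Deg []      = inj₁ ≋-refl
zero-or-Deg (a ∷ P) with zero-or-Deg P
zero-or-Deg (true ∷ P)  | inj₁ P≋0       = inj₂ (0 , mkDeg refl (DegBelow-∷ (DegBelow-resp-≋ (≋-sym P≋0) DegBelow-0)))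
zero-or-Deg (false ∷ P) | inj₁ P≋0       = inj₁ (≋-trans (∷-cong refl P≋0) false∷0≋0)
zero-or-Deg (a ∷ P)     | inj₂ (d , hP)  = inj₂ (suc d , Deg-∷ hP)

Deg-* : ∀ {P R p r} → Deg P p → Deg R r → Deg (P *ₚ R) (p + r)
Deg-* {a ∷ P} {R} {zero}  hP hR = Deg-resp-≋ (≋-sym (≋-trans (*-congʳ R (Deg0⇒≋1 hP)) (*-identityˡ R))) hR
Deg-* {a ∷ P} {p = suc p} {r} hP hR =
  Deg-+-lower (DegBelow-mono (s≤s (m≤n+m r p)) (DegBelow-scale a (below hR))) (Deg-∷ (Deg-* (Deg-tail hP) hR))

DegBelow-∣⇒≋0 : ∀ {M S d} → Deg M d → DegBelow S d → M ∣ S → S ≋ 0ₚ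
DegBelow-∣⇒≋0 {M} {d = d} hM bS (q , qM≋S) with zero-or-Deg q
... | inj₁ q≋0      = ≋-trans (≋-sym qM≋S) (≋0⇒*≋0 M q≋0)
... | inj₂ (e , hq) = contradiction (leading (Deg-resp-≋ qM≋S (Deg-* hq hM)))
                                    (≡false⇒≢true (coeff-≥ bS (e + d) (m≤n+m d e)))

Deg-X : Deg X 1
Deg-X = mkDeg refl (DegBelow-length X)

Deg-+-Deg : ∀ {P R d} → Deg P d → Deg R d → DegBelow (P +ₚ R) d
Deg-+-Deg {P} {R} {d} hP hR = degBelow λ i d≤i → trans (coeff-+ P R i) (vanish i d≤i)
  where
  vanish : ∀ i → d ≤ i → (coeff P i xor coeff R i) ≡ false
  vanish i d≤i with m≤n⇒m<n∨m≡n d≤i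
  ... | inj₁ d<i  = cong₂ _xor_ (coeff-≥ (below hP) i d<i) (coeff-≥ (below hR) i d<i)
  ... | inj₂ refl = cong₂ _xor_ (leading hP) (leading hR)

coeff-drop : ∀ n P m → coeff (drop n P) m ≡ coeff P (n + m)
coeff-drop zero    P       m = refl
coeff-drop (suc n) []      m = refl
coeff-drop (suc n) (a ∷ P) m = coeff-drop n P m

Deg-drop : ∀ n {P d} → Deg P (n + d) → Deg (drop n P) d
Deg-drop n {P} (mkDeg lead b) = mkDeg (trans (coeff-drop n P _) lead)
  (degBelow λ i d<i → trans (coeff-drop n P i) (coeff-≥ b (n + i) (+-monoʳ-< n d<i)))

Deg-DegBelow⇒< : ∀ {P d n} → Deg P d → DegBelow P n → d < n
Deg-DegBelow⇒< {d = d} hP bP = ≰⇒> λ n≤d → ≡false⇒≢true (coeff-≥ bP d n≤d) (leading hP)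

IsUnit-resp-≋ : ∀ {A A'} → A ≋ A' → IsUnit A → IsUnit A'
IsUnit-resp-≋ {A} e (B , AB≈1) = B , coeff-≡ (≋-trans (*-congʳ B (≋-sym e)) (mk≋ {A *ₚ B} {1ₚ} AB≈1))

∣1⇒IsUnit : ∀ {A} → A ∣ 1ₚ → IsUnit A
∣1⇒IsUnit {A} (q , qA≋1) = q , coeff-≡ (≋-trans (*-comm A q) qA≋1)

IsUnit⇒∣1 : ∀ {A} → IsUnit A → A ∣ 1ₚ
IsUnit⇒∣1 {A} (B , AB≈1) = B , ≋-trans (*-comm B A) (mk≋ {A *ₚ B} {1ₚ} AB≈1)

Deg0⇒IsUnit : ∀ {A} → Deg A 0 → IsUnit A
Deg0⇒IsUnit hA = ∣1⇒IsUnit (∣ʳ-respˡ-≈ (≋-sym (Deg0⇒≋1 hA)) ∣ʳ-refl)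

IsUnit⇒Deg0 : ∀ {A a} → Deg A a → IsUnit A → a ≡ 0
IsUnit⇒Deg0 {A} hA unit with IsUnit⇒∣1 unit
... | q , qA≋1 with zero-or-Deg q
...   | inj₁ q≋0      = contradiction (≋-trans (≋-sym qA≋1) (≋0⇒*≋0 A q≋0)) (Deg⇒≉0 Deg-1)
...   | inj₂ (e , hq) = m+n≡0⇒n≡0 e (Deg-unique (Deg-* hq hA) (Deg-resp-≋ (≋-sym qA≋1) Deg-1))

irreducible-by-degree : ∀ {P n} → Deg P (suc n) →
  (∀ {A B a b} → Deg A (suc a) → Deg B (suc b) → P ≋ (A *ₚ B) → ⊥) → Irreducible P
irreducible-by-degree {P} hP no-split =
  (λ P≈0 → Deg⇒≉0 hP (mk≋ {P} {0ₚ} P≈0)) , (λ unit → contradiction (IsUnit⇒Deg0 hP unit) λ ()) , split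
  where
  split : ∀ A B → P ≈ₚ (A *ₚ B) → IsUnit A ⊎ IsUnit B
  split A B P≈AB with zero-or-Deg A | zero-or-Deg B
  ... | inj₁ A≋0 | _ = contradiction (≋-trans (mk≋ {P} {A *ₚ B} P≈AB) (≋0⇒*≋0 B A≋0)) (Deg⇒≉0 hP)
  ... | inj₂ _ | inj₁ B≋0 =
    contradiction (≋-trans (mk≋ {P} {A *ₚ B} P≈AB) (≋-trans (*-comm A B) (≋0⇒*≋0 A B≋0))) (Deg⇒≉0 hP)
  ... | inj₂ (zero , hA) | inj₂ _ = inj₁ (Deg0⇒IsUnit hA)
  ... | inj₂ (suc _ , _) | inj₂ (zero , hB) = inj₂ (Deg0⇒IsUnit hB)
  ... | inj₂ (suc _ , hA) | inj₂ (suc _ , hB) = ⊥-elim (no-split hA hB (mk≋ {P} {A *ₚ B} P≈AB))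

positive-degree⇒nonunit : ∀ {A a} → Deg A (suc a) → ¬ IsUnit A
positive-degree⇒nonunit hA unit = contradiction (IsUnit⇒Deg0 hA unit) λ ()

nonunit⇒positive-degree : ∀ {A} → ¬ (A ≋ 0ₚ) → ¬ IsUnit A → ∃[ a ] Deg A (suc a)
nonunit⇒positive-degree {A} A≉0 nonunit with zero-or-Deg A
... | inj₁ A≋0            = contradiction A≋0 A≉0
... | inj₂ (zero , hA)    = contradiction (Deg0⇒IsUnit hA) nonunit
... | inj₂ (suc a , hA)   = a , hA

coeff-*-subleading : ∀ {A B a b} → Deg A (suc a) → Deg B (suc b) →
                     coeff (A *ₚ B) (suc (a + b)) ≡ coeff A a xor coeff B b
coeff-*-subleading {x ∷ _} {B} {zero} {b} hA hB = trans (coeff-+ (scale x B) _ (suc b))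
  (cong₂ _xor_ (trans (coeff-scale x B (suc b)) (trans (cong (x ∧_) (leading hB)) (∧-identityʳ x)))
               (coeff-≡ (≋-trans (*-congʳ B (Deg0⇒≋1 (Deg-tail hA))) (*-identityˡ B)) b))
coeff-*-subleading {x ∷ _} {B} {suc a} {b} hA hB = trans (coeff-+ (scale x B) _ (suc (suc a + b)))
  (cong₂ _xor_ (trans (coeff-scale x B _) (trans (cong (x ∧_) (coeff-≥ (below hB) _ b+2≤a+b+2)) (∧-zeroʳ x)))
               (coeff-*-subleading (Deg-tail hA) hB))
  where
  b+2≤a+b+2 : suc (suc b) ≤ suc (suc (a + b))
  b+2≤a+b+2 = s≤s (s≤s (m≤n+m b a))

IsUnit-* : ∀ {A B} → IsUnit A → IsUnit B → IsUnit (A *ₚ B)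
IsUnit-* {A} {B} (A⁻¹ , AA⁻¹≈1) (B⁻¹ , BB⁻¹≈1) = (A⁻¹ *ₚ B⁻¹) , coeff-≡ (begin
  (A *ₚ B) *ₚ (A⁻¹ *ₚ B⁻¹)    ≈⟨ regroup A B A⁻¹ B⁻¹ ⟩
  (A *ₚ A⁻¹) *ₚ (B *ₚ B⁻¹)    ≈⟨ *-cong (mk≋ {A *ₚ A⁻¹} {1ₚ} AA⁻¹≈1) (mk≋ {B *ₚ B⁻¹} {1ₚ} BB⁻¹≈1) ⟩
  1ₚ *ₚ 1ₚ                    ≈⟨ *-identityˡ 1ₚ ⟩
  1ₚ                          ∎)
  where
  open ≋-Reasoning
  regroup : ∀ A B C D → ((A *ₚ B) *ₚ (C *ₚ D)) ≋ ((A *ₚ C) *ₚ (B *ₚ D))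
  regroup = solve-∀ almostPolyRing

irreducible⇒¬square : ∀ {P R} → Irreducible P → ¬ (P ≋ (R *ₚ R))
irreducible⇒¬square {R = R} (_ , nonunit , split) P≋R² with split R R (coeff-≡ P≋R²)
... | inj₁ unit = nonunit (IsUnit-resp-≋ (≋-sym P≋R²) (IsUnit-* {R} {R} unit unit))
... | inj₂ unit = nonunit (IsUnit-resp-≋ (≋-sym P≋R²) (IsUnit-* {R} {R} unit unit))

-- Division with remainder, Bézout, irreducible polynomials

-- P mod M for M of degree d, by Horner's scheme: reduce the higher part, multiply by x, cancel the x^d term.
reduce : Poly → ℕ → Poly → Poly
reduce M d []      = []
reduce M d (a ∷ P) = (a ∷ reduce M d P) +ₚ scale (coeff (a ∷ reduce M d P) d) M

module Reduction {M : Poly} {d : ℕ} (hM : Deg M d) where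

  reduce-DegBelow : ∀ P → DegBelow (reduce M d P) d
  reduce-DegBelow []      = DegBelow-0
  reduce-DegBelow (a ∷ P) = degBelow vanish
    where
    S = a ∷ reduce M d P
    c = coeff S d
    vanish : ∀ i → d ≤ i → coeff (S +ₚ scale c M) i ≡ false
    vanish i d≤i with <-cmp d i
    ... | tri< d<i _ _ = trans (coeff-+ S (scale c M) i)
      (cong₂ _xor_ (coeff-≥ (DegBelow-∷ (reduce-DegBelow P)) i d<i)
                   (coeff-≥ (DegBelow-scale c (below hM)) i d<i))
    ... | tri≈ _ refl _ = trans (coeff-+ S (scale c M) d)
      (trans (cong (c xor_) (trans (coeff-scale c M d) (cong (c ∧_) (leading hM))))
             (trans (cong (c xor_) (∧-identityʳ c)) (xor-same c)))
    ... | tri> _ _ i<d = contradiction d≤i (<⇒≱ i<d)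

  ≡mod-reduce : ∀ P → P ≡ reduce M d P mod M
  ≡mod-reduce []      = ≡mod-refl
  ≡mod-reduce (a ∷ P) = ≡mod-trans (≡mod-∷ (≡mod-reduce P)) (≡mod-+-divisible (∣-scale (coeff (a ∷ reduce M d P) d)))

  reduced-≡mod⇒≋ : ∀ {S S'} → DegBelow S d → DegBelow S' d → S ≡ S' mod M → S ≋ S'
  reduced-≡mod⇒≋ bS bS' (mod-intro d) = sum≋0⇒≋ (DegBelow-∣⇒≋0 hM (DegBelow-+ bS bS') d)

  reduce-cong : ∀ {P P'} → P ≡ P' mod M → reduce M d P ≋ reduce M d P'
  reduce-cong {P} {P'} P≡P' = reduced-≡mod⇒≋ (reduce-DegBelow P) (reduce-DegBelow P')
    (≡mod-trans (≡mod-sym (≡mod-reduce P)) (≡mod-trans P≡P' (≡mod-reduce P')))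

  reduce-≋⇒≡mod : ∀ {P P'} → reduce M d P ≋ reduce M d P' → P ≡ P' mod M
  reduce-≋⇒≡mod {P} {P'} e = ≡mod-trans (≡mod-reduce P) (≡mod-trans (≋⇒≡mod e) (≡mod-sym (≡mod-reduce P')))

  reduce-id : ∀ {P} → DegBelow P d → reduce M d P ≋ P
  reduce-id {P} bP = reduced-≡mod⇒≋ (reduce-DegBelow P) bP (≡mod-sym (≡mod-reduce P))

  reduce-+ : ∀ P P' → reduce M d (P +ₚ P') ≋ (reduce M d P +ₚ reduce M d P')
  reduce-+ P P' = reduced-≡mod⇒≋ (reduce-DegBelow (P +ₚ P')) (DegBelow-+ (reduce-DegBelow P) (reduce-DegBelow P'))
    (≡mod-trans (≡mod-sym (≡mod-reduce (P +ₚ P'))) (≡mod-+ (≡mod-reduce P) (≡mod-reduce P')))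

record Bezout (A B : Poly) : Set where
  field
    gcd U V : Poly
    gcd≋    : gcd ≋ ((U *ₚ A) +ₚ (V *ₚ B))
    gcd∣A   : gcd ∣ A
    gcd∣B   : gcd ∣ B

bezout-bounded : ∀ n A B → DegBelow B n → Bezout A B
bezout-bounded n A B bB with zero-or-Deg B
... | inj₁ B≋0 = record
  { gcd = A ; U = 1ₚ ; V = 0ₚ ; gcd≋ = ≋-sym (≋-trans (+-identityʳ _) (*-identityˡ A))
  ; gcd∣A = ∣ʳ-refl ; gcd∣B = ∣ʳ-respʳ-≈ (≋-sym B≋0) (A ∣0) }
bezout-bounded (suc n) A B bB | inj₂ (k , hB) =
  step (bezout-bounded n B r (DegBelow-mono k≤n (reduce-DegBelow A))) (divides (≡mod-reduce A))
  where
  open Reduction hB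
  r = reduce B k A
  k≤n : k ≤ n
  k≤n = ≮⇒≥ λ n<k → ≡false⇒≢true (coeff-≥ bB k n<k) (leading hB)
  step : Bezout B r → B ∣ (A +ₚ r) → Bezout A B
  step b (q , qB≋A+r) = record
    { gcd = gcd ; U = V ; V = U +ₚ (V *ₚ q) ; gcd∣B = gcd∣B
    ; gcd≋ = ≋-trans gcd≋ (≋-trans (+-cong ≋-refl (*-congˡ V r≋A+qB)) (regroup A B U V q))
    ; gcd∣A = ∣ʳ-respʳ-≈ (≋-sym (+-move (≋-sym qB≋A+r))) (∣-+ (x∣ʳy⇒x∣ʳzy q gcd∣B) gcd∣r) }
    where
    open Bezout b renaming (gcd∣A to gcd∣B; gcd∣B to gcd∣r)
    r≋A+qB : r ≋ (A +ₚ (q *ₚ B))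
    r≋A+qB = ≋-trans (+-move (≋-trans (+-comm r A) (≋-sym qB≋A+r))) (+-comm _ A)
    regroup : ∀ A B U V q → ((U *ₚ B) +ₚ (V *ₚ (A +ₚ (q *ₚ B)))) ≋ ((V *ₚ A) +ₚ ((U +ₚ (V *ₚ q)) *ₚ B))
    regroup = solve-∀ almostPolyRing
bezout-bounded zero A B bB | inj₂ (k , hB) = contradiction (coeff-≥ bB k z≤n) (λ e → ≡false⇒≢true e (leading hB))

bezout : ∀ A B → Bezout A B
bezout A B = bezout-bounded (length B) A B (DegBelow-length B)

irreducible⇒divides-or-invertible : ∀ {Q} → Irreducible Q → ∀ S → (Q ∣ S) ⊎ (∃[ C ] ((S *ₚ C) ≡ 1ₚ mod Q))
irreducible⇒divides-or-invertible {Q} (_ , _ , split) S with bezout S Q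
... | record { gcd = g ; U = U ; V = V ; gcd≋ = g≋ ; gcd∣A = g∣S ; gcd∣B = (e , eg≋Q) }
    with split e g (coeff-≡ (≋-sym eg≋Q))
...   | inj₁ (e⁻¹ , ee⁻¹≈1) = inj₁ (∣ʳ-trans (e⁻¹ , e⁻¹Q≋g) g∣S)
  where
  e⁻¹Q≋g : (e⁻¹ *ₚ Q) ≋ g
  e⁻¹Q≋g = begin
    e⁻¹ *ₚ Q          ≈⟨ *-congˡ e⁻¹ (≋-sym eg≋Q) ⟩
    e⁻¹ *ₚ (e *ₚ g)   ≈⟨ regroup e⁻¹ e g ⟩
    g *ₚ (e *ₚ e⁻¹)   ≈⟨ *-congˡ g (mk≋ ee⁻¹≈1) ⟩
    g *ₚ 1ₚ           ≈⟨ *-identityʳ g ⟩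
    g                 ∎
    where
    open ≋-Reasoning
    regroup : ∀ x y z → (x *ₚ (y *ₚ z)) ≋ (z *ₚ (y *ₚ x))
    regroup = solve-∀ almostPolyRing
...   | inj₂ (g⁻¹ , gg⁻¹≈1) = inj₂ ((U *ₚ g⁻¹) , mod-intro ((V *ₚ g⁻¹) , SUg⁻¹+1≋VQg⁻¹))
  where
  SUg⁻¹+1≋VQg⁻¹ : ((V *ₚ g⁻¹) *ₚ Q) ≋ ((S *ₚ (U *ₚ g⁻¹)) +ₚ 1ₚ)
  SUg⁻¹+1≋VQg⁻¹ = ≋-trans (+-move (begin
    ((V *ₚ g⁻¹) *ₚ Q) +ₚ (S *ₚ (U *ₚ g⁻¹))   ≈⟨ regroup V g⁻¹ Q S U ⟩
    ((U *ₚ S) +ₚ (V *ₚ Q)) *ₚ g⁻¹             ≈⟨ *-congʳ g⁻¹ (≋-sym g≋) ⟩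
    g *ₚ g⁻¹                                  ≈⟨ mk≋ gg⁻¹≈1 ⟩
    1ₚ                                        ∎)) (+-comm 1ₚ _)
    where
    open ≋-Reasoning
    regroup : ∀ V g⁻¹ Q S U → (((V *ₚ g⁻¹) *ₚ Q) +ₚ (S *ₚ (U *ₚ g⁻¹))) ≋ (((U *ₚ S) +ₚ (V *ₚ Q)) *ₚ g⁻¹)
    regroup = solve-∀ almostPolyRing

irreducible⇒prime : ∀ {Q} → Irreducible Q → ∀ S R → Q ∣ (S *ₚ R) → (Q ∣ S) ⊎ (Q ∣ R)
irreducible⇒prime {Q} irr S R Q∣SR with irreducible⇒divides-or-invertible irr S
... | inj₁ Q∣S        = inj₁ Q∣S
... | inj₂ (C , SC≡1) = inj₂ (≡mod0⇒∣ (begin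
  R                ≈⟨ ≋⇒≡mod (≋-sym (*-identityʳ R)) ⟩
  R *ₚ 1ₚ          ≈⟨ ≡mod-* (≡mod-refl {A = R}) (≡mod-sym SC≡1) ⟩
  R *ₚ (S *ₚ C)    ≈⟨ ≋⇒≡mod (regroup R S C) ⟩
  (S *ₚ R) *ₚ C    ≈⟨ ≡mod-* (∣⇒≡mod0 Q∣SR) (≡mod-refl {A = C}) ⟩
  0ₚ               ∎))
  where
  open ≡mod-Reasoning Q
  regroup : ∀ R S C → (R *ₚ (S *ₚ C)) ≋ ((S *ₚ R) *ₚ C)
  regroup = solve-∀ almostPolyRing

ProperFactorization : Poly → Set
ProperFactorization P = ∃[ F ] ∃[ G ] (¬ IsUnit F × ¬ IsUnit G × P ≋ (F *ₚ G))

gcd-factorization : ∀ {P A} → P ∣ (A *ₚ (A +ₚ 1ₚ)) → ¬ (P ∣ A) → ¬ (P ∣ (A +ₚ 1ₚ)) →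
                    ProperFactorization P
gcd-factorization {P} {A} P∣A[A+1] P∤A P∤A+1 = from-gcd (bezout P A)
  where
  from-gcd : Bezout P A → ProperFactorization P
  from-gcd record { gcd = G ; U = U ; V = V ; gcd≋ = G≋UP+VA ; gcd∣A = (E , EG≋P) ; gcd∣B = G∣A } =
    G , E , G-nonunit , E-nonunit , ≋-trans (≋-sym EG≋P) (*-comm E G)
    where
    G-nonunit : ¬ IsUnit G
    G-nonunit (G⁻¹ , GG⁻¹≈1) = P∤A+1 (∣ʳ-respʳ-≈ (≋-sym A+1≋) (∣-+ (x∣xy P _) (∣-*ʳ (V *ₚ G⁻¹) P∣A[A+1])))
      where
      regroup : ∀ A P U V G⁻¹ → ((A +ₚ 1ₚ) *ₚ (((U *ₚ P) +ₚ (V *ₚ A)) *ₚ G⁻¹))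
                              ≋ ((P *ₚ (((A +ₚ 1ₚ) *ₚ U) *ₚ G⁻¹)) +ₚ ((A *ₚ (A +ₚ 1ₚ)) *ₚ (V *ₚ G⁻¹)))
      regroup = solve-∀ almostPolyRing
      A+1≋ : (A +ₚ 1ₚ) ≋ ((P *ₚ (((A +ₚ 1ₚ) *ₚ U) *ₚ G⁻¹)) +ₚ ((A *ₚ (A +ₚ 1ₚ)) *ₚ (V *ₚ G⁻¹)))
      A+1≋ = begin
        A +ₚ 1ₚ                                              ≈⟨ *-identityʳ _ ⟨
        (A +ₚ 1ₚ) *ₚ 1ₚ                                      ≈⟨ *-congˡ (A +ₚ 1ₚ) (mk≋ {G *ₚ G⁻¹} {1ₚ} GG⁻¹≈1) ⟨
        (A +ₚ 1ₚ) *ₚ (G *ₚ G⁻¹)                              ≈⟨ *-congˡ (A +ₚ 1ₚ) (*-congʳ G⁻¹ G≋UP+VA) ⟩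
        (A +ₚ 1ₚ) *ₚ (((U *ₚ P) +ₚ (V *ₚ A)) *ₚ G⁻¹)         ≈⟨ regroup A P U V G⁻¹ ⟩
        (P *ₚ (((A +ₚ 1ₚ) *ₚ U) *ₚ G⁻¹)) +ₚ ((A *ₚ (A +ₚ 1ₚ)) *ₚ (V *ₚ G⁻¹))  ∎
        where open ≋-Reasoning
    E-nonunit : ¬ IsUnit E
    E-nonunit (E⁻¹ , EE⁻¹≈1) = P∤A (∣ʳ-trans (E⁻¹ , E⁻¹P≋G) G∣A)
      where
      regroup : ∀ E⁻¹ E G → (E⁻¹ *ₚ (E *ₚ G)) ≋ ((E *ₚ E⁻¹) *ₚ G)
      regroup = solve-∀ almostPolyRing
      E⁻¹P≋G : (E⁻¹ *ₚ P) ≋ G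
      E⁻¹P≋G = begin
        E⁻¹ *ₚ P              ≈⟨ *-congˡ E⁻¹ EG≋P ⟨
        E⁻¹ *ₚ (E *ₚ G)       ≈⟨ regroup E⁻¹ E G ⟩
        (E *ₚ E⁻¹) *ₚ G       ≈⟨ *-congʳ G (mk≋ {E *ₚ E⁻¹} {1ₚ} EE⁻¹≈1) ⟩
        1ₚ *ₚ G               ≈⟨ *-identityˡ G ⟩
        G                     ∎
        where open ≋-Reasoning

-- Counting residues

toFin : ∀ {n} → Vec Bool n → Fin (2 ^ n)
toFin []      = zero
toFin (b ∷ v) = combine (Bool⇒bit b) (toFin v)

fromFin : ∀ {n} → Fin (2 ^ n) → Vec Bool n
fromFin {zero}  _ = []
fromFin {suc n} i = bit⇒Bool (proj₁ (remQuot {2} (2 ^ n) i)) ∷ fromFin (proj₂ (remQuot {2} (2 ^ n) i))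

fromFin-toFin : ∀ {n} (v : Vec Bool n) → fromFin (toFin v) ≡ v
fromFin-toFin []              = refl
fromFin-toFin {suc n} (b ∷ v) = trans
  (cong (λ (i , j) → bit⇒Bool i ∷ fromFin j) (remQuot-combine {2} {2 ^ n} (Bool⇒bit b) (toFin v)))
  (cong₂ _∷_ (bit⇒Bool∘Bool⇒bit b) (fromFin-toFin v))

toFin-fromFin : ∀ {n} (i : Fin (2 ^ n)) → toFin (fromFin {n} i) ≡ i
toFin-fromFin {zero}  zero = refl
toFin-fromFin {suc n} i = trans
  (cong₂ combine (Bool⇒bit∘bit⇒Bool (proj₁ (remQuot {2} (2 ^ n) i)))
                 (toFin-fromFin {n} (proj₂ (remQuot {2} (2 ^ n) i))))
  (combine-remQuot {2} (2 ^ n) i)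

toFin-injective : ∀ {n} → Injective _≡_ _≡_ (toFin {n})
toFin-injective {x = v} {w} e = trans (sym (fromFin-toFin v)) (trans (cong fromFin e) (fromFin-toFin w))

fin-injective⇒surjective : ∀ {n} (f : Fin n → Fin n) → Injective _≡_ _≡_ f → ∀ y → ∃[ x ] f x ≡ y
fin-injective⇒surjective {suc _} f f-inj y with any? (λ x → f x ≟ y)
... | yes hit = hit
... | no miss = contradiction (injective⇒≤ punched-injective) 1+n≰n
  where
  f≢y : ∀ x → y ≢ f x
  f≢y x y≡fx = miss (x , sym y≡fx)
  punched-injective : Injective _≡_ _≡_ (λ x → punchOut (f≢y x))
  punched-injective e = f-inj (punchOut-injective (f≢y _) (f≢y _) e)

coeffs : (n : ℕ) → Poly → Vec Bool n
coeffs zero    P = []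
coeffs (suc n) P = coeff P 0 ∷ coeffs n (drop 1 P)

coeffs-cong : ∀ n {P R} → P ≋ R → coeffs n P ≡ coeffs n R
coeffs-cong zero    e = refl
coeffs-cong (suc n) {P} {R} e = cong₂ _∷_ (coeff-≡ e 0) (coeffs-cong n (mk≋ λ i →
  trans (coeff-drop 1 P i) (trans (coeff-≡ e (suc i)) (sym (coeff-drop 1 R i)))))

coeffs-injective : ∀ n {P R} → DegBelow P n → DegBelow R n → coeffs n P ≡ coeffs n R → P ≋ R
coeffs-injective zero    bP bR _ = ≋-trans (DegBelow0⇒≋0 bP) (≋-sym (DegBelow0⇒≋0 bR))
coeffs-injective (suc n) {P} {R} bP bR e with Vec.∷-injective e
... | P₀≡R₀ , tails≡ = mk≋ λ
  { zero    → P₀≡R₀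
  ; (suc i) → trans (sym (coeff-drop 1 P i)) (trans (coeff-≡ tails≋ i) (coeff-drop 1 R i)) }
  where
  DegBelow-drop1 : ∀ {S} → DegBelow S (suc n) → DegBelow (drop 1 S) n
  DegBelow-drop1 {S} bS = degBelow λ i n≤i → trans (coeff-drop 1 S i) (coeff-≥ bS (suc i) (s≤s n≤i))
  tails≋ : drop 1 P ≋ drop 1 R
  tails≋ = coeffs-injective n (DegBelow-drop1 bP) (DegBelow-drop1 bR) tails≡

coeffs-toList : ∀ {n} (v : Vec Bool n) → coeffs n (toList v) ≡ v
coeffs-toList []      = refl
coeffs-toList (b ∷ v) = cong (b ∷_) (coeffs-toList v)

DegBelow-toList : ∀ {n} (v : Vec Bool n) → DegBelow (toList v) n
DegBelow-toList []      = DegBelow-0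
DegBelow-toList (b ∷ v) = DegBelow-∷ (DegBelow-toList v)

-- Polynomials of degree < n are the 2 ^ n vectors of their coefficients, so injections between such
-- sets obey the pigeonhole principle.
record BoundedInjection (n m : ℕ) : Set where
  field
    map       : Poly → Poly
    map-below : ∀ P → DegBelow (map P) m
    injective : ∀ {P R} → DegBelow P n → DegBelow R n → map P ≋ map R → P ≋ R

  onVectors : Vec Bool n → Vec Bool m
  onVectors v = coeffs m (map (toList v))

  onVectors-injective : Injective _≡_ _≡_ onVectors
  onVectors-injective {v} {w} e = begin
    v                     ≡⟨ coeffs-toList v ⟨
    coeffs n (toList v)   ≡⟨ coeffs-cong n (injective (DegBelow-toList v) (DegBelow-toList w)
                               (coeffs-injective m (map-below _) (map-below _) e)) ⟩
    coeffs n (toList w)   ≡⟨ coeffs-toList w ⟩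
    w                     ∎
    where open ≡-Reasoning

  onFin : Fin (2 ^ n) → Fin (2 ^ m)
  onFin = toFin ∘ onVectors ∘ fromFin

  onFin-injective : Injective _≡_ _≡_ onFin
  onFin-injective {i} {j} e = begin
    i                      ≡⟨ toFin-fromFin {n} i ⟨
    toFin (fromFin {n} i)  ≡⟨ cong toFin (onVectors-injective (toFin-injective e)) ⟩
    toFin (fromFin {n} j)  ≡⟨ toFin-fromFin {n} j ⟩
    j                      ∎
    where open ≡-Reasoning

  dimension-≤ : n ≤ m
  dimension-≤ = ≮⇒≥ λ m<n → contradiction (injective⇒≤ onFin-injective) (<⇒≱ (^-monoʳ-< 2 (s≤s (s≤s z≤n)) m<n))

module _ {n} (ι : BoundedInjection n n) where

  open BoundedInjection ι

  -- Abstract, so that type checking never unfolds the search for the preimage.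
  abstract
    surjective : ∀ T → DegBelow T n → ∃[ P ] (DegBelow P n × map P ≋ T)
    surjective T bT = preimage (fin-injective⇒surjective onFin onFin-injective (toFin (coeffs n T)))
      where
      preimage : ∃[ i ] onFin i ≡ toFin (coeffs n T) → ∃[ P ] (DegBelow P n × map P ≋ T)
      preimage (i , hit) = toList v , DegBelow-toList v , coeffs-injective n (map-below (toList v)) bT hits
        where
        v : Vec Bool n
        v = fromFin {n} i
        hits : coeffs n (map (toList v)) ≡ coeffs n T
        hits = toFin-injective hit

isOdd : ℕ → Bool
isOdd zero    = false
isOdd (suc n) = not (isOdd n)

isOdd-+ : ∀ m n → isOdd (m + n) ≡ isOdd m xor isOdd n
isOdd-+ zero    n = refl
isOdd-+ (suc m) n = trans (cong not (isOdd-+ m n)) (not-distribˡ-xor (isOdd m) (isOdd n))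

isOdd-even : ∀ m → isOdd (2 * m) ≡ false
isOdd-even m =
  trans (isOdd-+ m (m + 0)) (trans (cong (λ n → isOdd m xor isOdd n) (ℕ.+-identityʳ m)) (xor-same (isOdd m)))

isOdd-odd : ∀ m → isOdd (2 * m + 1) ≡ true
isOdd-odd m = trans (isOdd-+ (2 * m) 1) (cong (_xor true) (isOdd-even m))

xor≡false⇒≡ : ∀ {a b} → (a xor b) ≡ false → a ≡ b
xor≡false⇒≡ {false} {false} _ = refl
xor≡false⇒≡ {true}  {true}  _ = refl

xor≡true⇒≢ : ∀ {a b} → (a xor b) ≡ true → a ≢ b
xor≡true⇒≢ {false} {false} () _
xor≡true⇒≢ {true}  {true}  () _

xor-middleFour : ∀ a b c d → (a xor b) xor (c xor d) ≡ (a xor c) xor (b xor d)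
xor-middleFour = comm∧assoc⇒middleFour xor-comm xor-assoc

xor-cancel-middle : ∀ a b c → (a xor b) xor (b xor c) ≡ a xor c
xor-cancel-middle a b c = begin
  (a xor b) xor (b xor c)   ≡⟨ xor-assoc a b (b xor c) ⟩
  a xor (b xor (b xor c))   ≡⟨ cong (a xor_) (sym (xor-assoc b b c)) ⟩
  a xor ((b xor b) xor c)   ≡⟨ cong (λ z → a xor (z xor c)) (xor-same b) ⟩
  a xor c                   ∎
  where open ≡-Reasoning

xorSum : ℕ → (ℕ → Bool) → Bool
xorSum zero    f = false
xorSum (suc n) f = f 0 xor xorSum n (f ∘ suc)

xorSum-cong : ∀ n {f g} → (∀ i → i < n → f i ≡ g i) → xorSum n f ≡ xorSum n g
xorSum-cong zero    e = refl
xorSum-cong (suc n) e = cong₂ _xor_ (e 0 (s≤s z≤n)) (xorSum-cong n λ i i<n → e (suc i) (s≤s i<n))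

xorSum-xor : ∀ n f g → xorSum n (λ i → f i xor g i) ≡ xorSum n f xor xorSum n g
xorSum-xor zero    f g = refl
xorSum-xor (suc n) f g = trans (cong ((f 0 xor g 0) xor_) (xorSum-xor n (f ∘ suc) (g ∘ suc)))
                               (xor-middleFour (f 0) (g 0) _ _)

xorSum-∧ : ∀ n a f → xorSum n (λ i → a ∧ f i) ≡ a ∧ xorSum n f
xorSum-∧ zero    a f = sym (∧-zeroʳ a)
xorSum-∧ (suc n) a f = trans (cong ((a ∧ f 0) xor_) (xorSum-∧ n a (f ∘ suc))) (sym (∧-distribˡ-xor a (f 0) _))

xorSum-const : ∀ n c → xorSum n (λ _ → c) ≡ c ∧ isOdd n
xorSum-const zero    c = sym (∧-zeroʳ c)
xorSum-const (suc n) true  = cong not (xorSum-const n true)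
xorSum-const (suc n) false = xorSum-const n false

xorSum-δ : ∀ n (a : ℕ → Bool) i → i < n → xorSum n (λ j → a j ∧ (j ≡ᵇ i)) ≡ a i
xorSum-δ (suc n) a zero    _         =
  trans (cong₂ _xor_ (∧-identityʳ (a 0)) (trans (xorSum-cong n λ j _ → ∧-zeroʳ (a (suc j))) (xorSum-const n false)))
        (xor-identityʳ (a 0))
xorSum-δ (suc n) a (suc i) (s≤s i<n) =
  trans (cong (_xor xorSum n (λ j → a (suc j) ∧ (j ≡ᵇ i))) (∧-zeroʳ (a 0))) (xorSum-δ n (a ∘ suc) i i<n)

xorSum-diagonal : ∀ n (g : ℕ → ℕ → Bool) → (∀ i j → g i j ≡ g j i) →
                  xorSum n (λ i → xorSum n (g i)) ≡ xorSum n (λ i → g i i)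
xorSum-diagonal zero    g g-sym = refl
xorSum-diagonal (suc n) g g-sym = begin
  (g 0 0 xor row) xor xorSum n (λ i → g (suc i) 0 xor xorSum n (g (suc i) ∘ suc))
    ≡⟨ cong ((g 0 0 xor row) xor_) (xorSum-xor n (λ i → g (suc i) 0) (λ i → xorSum n (g (suc i) ∘ suc))) ⟩
  (g 0 0 xor row) xor (column xor xorSum n (λ i → xorSum n (g (suc i) ∘ suc)))
    ≡⟨ cong₂ (λ c rest → (g 0 0 xor row) xor (c xor rest)) (xorSum-cong n λ i _ → g-sym (suc i) 0)
             (xorSum-diagonal n (λ i j → g (suc i) (suc j)) (λ i j → g-sym (suc i) (suc j))) ⟩
  (g 0 0 xor row) xor (row xor xorSum n (λ i → g (suc i) (suc i)))
    ≡⟨ xor-cancel-middle (g 0 0) row _ ⟩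
  g 0 0 xor xorSum n (λ i → g (suc i) (suc i))   ∎
  where
  open ≡-Reasoning
  row = xorSum n (g 0 ∘ suc)
  column = xorSum n (λ i → g (suc i) 0)

xorSum-last : ∀ k f → (∀ i → i < k → f i ≡ false) → xorSum (suc k) f ≡ f k
xorSum-last zero    f _      = xor-identityʳ (f 0)
xorSum-last (suc k) f f<k≡0 =
  cong₂ _xor_ (f<k≡0 0 (s≤s z≤n)) (xorSum-last k (f ∘ suc) λ i i<k → f<k≡0 (suc i) (s≤s i<k))

leq : ℕ → ℕ → Bool
leq zero    m       = true
leq (suc i) zero    = false
leq (suc i) (suc m) = leq i m

xorSum-leq : ∀ n m → m < n → xorSum n (λ i → leq i m) ≡ isOdd (suc m)
xorSum-leq (suc n) zero    _         = cong not (xorSum-const n false)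
xorSum-leq (suc n) (suc m) (s≤s m<n) = cong not (xorSum-leq n m m<n)

polySum : ℕ → (ℕ → Poly) → Poly
polySum zero    h = 0ₚ
polySum (suc n) h = h 0 +ₚ polySum n (h ∘ suc)

coeff-polySum : ∀ n h i → coeff (polySum n h) i ≡ xorSum n (λ j → coeff (h j) i)
coeff-polySum zero    h i = refl
coeff-polySum (suc n) h i = trans (coeff-+ (h 0) _ i) (cong (coeff (h 0) i xor_) (coeff-polySum n (h ∘ suc) i))

polySum-cong : ∀ n {h h'} → (∀ j → j < n → h j ≋ h' j) → polySum n h ≋ polySum n h'
polySum-cong zero    e = ≋-refl
polySum-cong (suc n) e = +-cong (e 0 (s≤s z≤n)) (polySum-cong n λ j j<n → e (suc j) (s≤s j<n))

*-polySum : ∀ S n h → (S *ₚ polySum n h) ≋ polySum n (λ j → S *ₚ h j)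
*-polySum S zero    h = *-zeroʳ S
*-polySum S (suc n) h = ≋-trans (*-distribˡ S (h 0) _) (+-cong ≋-refl (*-polySum S n (h ∘ suc)))

∷0-polySum : ∀ n h → (false ∷ polySum n h) ≋ polySum n (λ j → false ∷ h j)
∷0-polySum zero    h = false∷0≋0
∷0-polySum (suc n) h = +-cong ≋-refl (∷0-polySum n (h ∘ suc))

shift : ℕ → Poly → Poly
shift zero    P = P
shift (suc k) P = false ∷ shift k P

infix 25 x^_
x^_ : ℕ → Poly
x^ k = shift k 1ₚ

coeff-x^ : ∀ j i → coeff (x^ j) i ≡ (j ≡ᵇ i)
coeff-x^ zero    zero    = refl
coeff-x^ zero    (suc i) = refl
coeff-x^ (suc j) zero    = refl
coeff-x^ (suc j) (suc i) = coeff-x^ j i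

≢⇒≡ᵇ≡false : ∀ {j i} → j ≢ i → (j ≡ᵇ i) ≡ false
≢⇒≡ᵇ≡false {zero}  {zero}  j≢i = contradiction refl j≢i
≢⇒≡ᵇ≡false {zero}  {suc i} j≢i = refl
≢⇒≡ᵇ≡false {suc j} {zero}  j≢i = refl
≢⇒≡ᵇ≡false {suc j} {suc i} j≢i = ≢⇒≡ᵇ≡false (j≢i ∘ cong suc)

≡ᵇ-refl : ∀ n → (n ≡ᵇ n) ≡ true
≡ᵇ-refl n = Equivalence.to T-≡ (≡⇒≡ᵇ n n refl)

shift-cong : ∀ k {P R} → P ≋ R → shift k P ≋ shift k R
shift-cong zero    e = e
shift-cong (suc k) e = ∷-cong refl (shift-cong k e)

shift-+ : ∀ k P R → shift k (P +ₚ R) ≋ (shift k P +ₚ shift k R)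
shift-+ zero    P R = ≋-refl
shift-+ (suc k) P R = ∷-cong refl (shift-+ k P R)

shift-*ˡ : ∀ k P R → (shift k P *ₚ R) ≋ shift k (P *ₚ R)
shift-*ˡ zero    P R = ≋-refl
shift-*ˡ (suc k) P R = ∷-cong refl (shift-*ˡ k P R)

shift≋x^* : ∀ k P → shift k P ≋ (x^ k *ₚ P)
shift≋x^* k P = ≋-sym (≋-trans (shift-*ˡ k 1ₚ P) (shift-cong k (*-identityˡ P)))

shift-*ʳ : ∀ k P R → (P *ₚ shift k R) ≋ shift k (P *ₚ R)
shift-*ʳ k P R = ≋-trans (*-comm P (shift k R)) (≋-trans (shift-*ˡ k R P) (shift-cong k (*-comm R P)))

shift-≡mod : ∀ {M P R} k → P ≡ R mod M → shift k P ≡ shift k R mod M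
shift-≡mod {M} {P} {R} k P≡R = begin
  shift k P       ≈⟨ ≋⇒≡mod (shift≋x^* k P) ⟩
  x^ k *ₚ P       ≈⟨ ≡mod-* (≡mod-refl {A = x^ k}) P≡R ⟩
  x^ k *ₚ R       ≈⟨ ≋⇒≡mod (shift≋x^* k R) ⟨
  shift k R       ∎
  where open ≡mod-Reasoning M

DegBelow-shift : ∀ t {P n} → DegBelow P n → DegBelow (shift t P) (t + n)
DegBelow-shift zero    b = b
DegBelow-shift (suc t) b = DegBelow-∷ (DegBelow-shift t b)

Deg-shift : ∀ t {P d} → Deg P d → Deg (shift t P) (t + d)
Deg-shift zero    h = h
Deg-shift (suc t) h = Deg-∷ (Deg-shift t h)

shift-∷0 : ∀ i P → shift i (false ∷ P) ≡ (false ∷ shift i P)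
shift-∷0 zero    P = refl
shift-∷0 (suc i) P = cong (false ∷_) (shift-∷0 i P)

coeff-shift-self : ∀ i P → coeff (shift i P) i ≡ coeff P 0
coeff-shift-self zero    P = refl
coeff-shift-self (suc i) P = coeff-shift-self i P

DegBelow-shift-const : ∀ i {c} → DegBelow (shift i [ c ]) (suc i)
DegBelow-shift-const zero    = DegBelow-const
DegBelow-shift-const (suc i) = DegBelow-∷ (DegBelow-shift-const i)

shift-0 : ∀ n → shift n 0ₚ ≋ 0ₚ
shift-0 zero    = ≋-refl
shift-0 (suc n) = ≋-trans (∷-cong refl (shift-0 n)) false∷0≋0

shift-shift : ∀ m n P → shift (m + n) P ≡ shift m (shift n P)
shift-shift zero    n P = refl
shift-shift (suc m) n P = cong (false ∷_) (shift-shift m n P)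

Deg-x^ : ∀ j → Deg (x^ j) j
Deg-x^ zero    = Deg-1
Deg-x^ (suc j) = Deg-∷ (Deg-x^ j)

≋take+shift-drop : ∀ n P → P ≋ (take n P +ₚ shift n (drop n P))
≋take+shift-drop zero    P       = ≋-refl
≋take+shift-drop (suc n) []      = ≋-sym (shift-0 (suc n))
≋take+shift-drop (suc n) (a ∷ P) = ∷-cong (sym (xor-identityʳ a)) (≋take+shift-drop n P)

DegBelow-take : ∀ n P → DegBelow (take n P) n
DegBelow-take zero    P       = DegBelow-0
DegBelow-take (suc n) []      = DegBelow-0
DegBelow-take (suc n) (a ∷ P) = DegBelow-∷ (DegBelow-take n P)

coeff-shift-drop : ∀ i P m → coeff (shift i (drop (suc i) P)) m ≡ leq i m ∧ coeff P (suc m)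
coeff-shift-drop zero    []      m       = refl
coeff-shift-drop zero    (a ∷ P) m       = refl
coeff-shift-drop (suc i) P       zero    = refl
coeff-shift-drop (suc i) []      (suc m) = trans (coeff-≡ (shift-0 i) m) (sym (∧-zeroʳ (leq i m)))
coeff-shift-drop (suc i) (a ∷ P) (suc m) = coeff-shift-drop i P m

*-as-polySum : ∀ n S T → DegBelow T n → (S *ₚ T) ≋ polySum n (λ j → scale (coeff T j) (shift j S))
*-as-polySum zero    S T       bT = ≋-trans (*-congˡ S (DegBelow0⇒≋0 bT)) (*-zeroʳ S)
*-as-polySum (suc n) S []      bT = *-as-polySum n S [] DegBelow-0
*-as-polySum (suc n) S (t ∷ T) bT = begin
  S *ₚ (t ∷ T)
    ≈⟨ *-∷ʳ S t T ⟩
  scale t S +ₚ (false ∷ (S *ₚ T))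
    ≈⟨ +-cong ≋-refl (∷-cong refl (*-as-polySum n S T (DegBelow-tail bT))) ⟩
  scale t S +ₚ (false ∷ polySum n (λ j → scale (coeff T j) (shift j S)))
    ≈⟨ +-cong ≋-refl (∷0-polySum n _) ⟩
  scale t S +ₚ polySum n (λ j → false ∷ scale (coeff T j) (shift j S))
    ≈⟨ +-cong ≋-refl (polySum-cong n λ j _ → ≋-sym (scale-∷0 (coeff T j) (shift j S))) ⟩
  scale t S +ₚ polySum n (λ j → scale (coeff T j) (shift (suc j) S))  ∎
  where open ≋-Reasoning

-- Substituting c + x + x²

[]+-scale : ∀ a P → ([ a ] +ₚ P) ≋ (scale a 1ₚ +ₚ P)
[]+-scale true  P = ≋-refl
[]+-scale false P = +-cong false∷0≋0 ≋-refl

[]*-scale : ∀ a P → ([ a ] *ₚ P) ≋ scale a P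
[]*-scale a P = ≋-trans (+-cong ≋-refl false∷0≋0) (+-identityʳ (scale a P))

compose-≋0 : ∀ {A} R → A ≋ 0ₚ → compose A R ≋ 0ₚ
compose-≋0 {[]}    R A≋0 = ≋-refl
compose-≋0 {a ∷ A} R A≋0 with ∷≋0-inversion A≋0
... | refl , A≋0′ = ≋-trans ([]+-scale false _) (≋-trans (*-congˡ R (compose-≋0 R A≋0′)) (*-zeroʳ R))

compose-congˡ : ∀ {A A'} R → A ≋ A' → compose A R ≋ compose A' R
compose-congˡ {[]}    {[]}     R e = ≋-refl
compose-congˡ {[]}    {b ∷ A'} R e = ≋-sym (compose-≋0 R (≋-sym e))
compose-congˡ {a ∷ A} {[]}     R e = compose-≋0 R e
compose-congˡ {a ∷ A} {b ∷ A'} R e with ∷-injective e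
... | refl , A≋A' = +-cong ≋-refl (*-congˡ R (compose-congˡ R A≋A'))

compose-+ : ∀ A B R → compose (A +ₚ B) R ≋ (compose A R +ₚ compose B R)
compose-+ []      B       R = ≋-refl
compose-+ (a ∷ A) []      R = ≋-sym (+-identityʳ _)
compose-+ (a ∷ A) (b ∷ B) R =
  ≋-trans (+-cong {[ a xor b ]} ≋-refl (≋-trans (*-congˡ R (compose-+ A B R)) (*-distribˡ R _ _)))
          (+-middleFour [ a ] [ b ] (R *ₚ compose A R) (R *ₚ compose B R))

compose-scale : ∀ a A R → compose (scale a A) R ≋ scale a (compose A R)
compose-scale true  A R = ≋-refl
compose-scale false A R = ≋-refl

compose-* : ∀ A B R → compose (A *ₚ B) R ≋ (compose A R *ₚ compose B R)
compose-* []      B R = ≋-refl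
compose-* (a ∷ A) B R = begin
  compose (scale a B +ₚ (false ∷ (A *ₚ B))) R
    ≈⟨ compose-+ (scale a B) (false ∷ (A *ₚ B)) R ⟩
  compose (scale a B) R +ₚ compose (false ∷ (A *ₚ B)) R
    ≈⟨ +-cong (compose-scale a B R) (≋-trans ([]+-scale false _) (*-congˡ R (compose-* A B R))) ⟩
  scale a (compose B R) +ₚ (R *ₚ (compose A R *ₚ compose B R))
    ≈⟨ +-cong ([]*-scale a (compose B R)) (*-assoc R _ _) ⟨
  ([ a ] *ₚ compose B R) +ₚ ((R *ₚ compose A R) *ₚ compose B R)
    ≈⟨ *-distribʳ (compose B R) [ a ] (R *ₚ compose A R) ⟨
  compose (a ∷ A) R *ₚ compose B R  ∎
  where open ≋-Reasoning

compose-∣ : ∀ {M S} R → M ∣ S → compose M R ∣ compose S R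
compose-∣ {M} R (q , qM≋S) = compose q R , ≋-trans (≋-sym (compose-* q M R)) (compose-congˡ R qM≋S)

compose-≡mod : ∀ {M A B} R → A ≡ B mod M → compose A R ≡ compose B R mod compose M R
compose-≡mod {A = A} {B} R (mod-intro d) = mod-intro (∣ʳ-respʳ-≈ (compose-+ A B R) (compose-∣ R d))

compose-const : ∀ a R → compose [ a ] R ≋ [ a ]
compose-const a R = ≋-trans (+-cong ≋-refl (*-zeroʳ R)) (+-identityʳ [ a ])

compose-X : ∀ R → compose X R ≋ R
compose-X R = ≋-trans ([]+-scale false _) (≋-trans (*-congˡ R (compose-const true R)) (*-identityʳ R))

Deg-compose : ∀ {A R d e} → Deg R (suc e) → Deg A d → Deg (compose A R) (d * suc e)
Deg-compose {a ∷ A} {R} {zero} hR hA =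
  Deg-resp-≋ (≋-sym (≋-trans (compose-congˡ R (Deg0⇒≋1 hA)) (compose-const true R))) Deg-1
Deg-compose {a ∷ A} {d = suc _} hR hA =
  Deg-+-lower DegBelow-const (Deg-* hR (Deg-compose hR (Deg-tail hA)))

DegBelow-compose : ∀ {R Z e z} → Deg R (suc e) → DegBelow Z (suc z) → DegBelow (compose Z R) (suc (z * suc e))
DegBelow-compose {R} {Z} hR bZ with zero-or-Deg Z
... | inj₁ Z≋0       = DegBelow-resp-≋ (≋-sym (compose-≋0 R Z≋0)) DegBelow-0
... | inj₂ (d , hZ) = DegBelow-mono (s≤s (*-monoˡ-≤ _ (≤-pred (Deg-DegBelow⇒< hZ bZ)))) (below (Deg-compose hR hZ))

Deg-c+x+x² : ∀ c → Deg (c+x+x² c) 2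
Deg-c+x+x² c = mkDeg refl (DegBelow-length (c+x+x² c))

coeff-[]+ : ∀ a P i → coeff ([ a ] +ₚ P) (suc i) ≡ coeff P (suc i)
coeff-[]+ a []      i = refl
coeff-[]+ a (b ∷ P) i = refl

coeff-c+x+x²* : ∀ c C i →
  coeff (c+x+x² c *ₚ C) (suc i) ≡ (c ∧ coeff C (suc i)) xor (coeff C i xor coeff (false ∷ C) i)
coeff-c+x+x²* c C i = trans (coeff-+ (scale c C) _ (suc i))
  (cong₂ _xor_ (coeff-scale c C (suc i))
               (trans (coeff-+ C _ i) (cong (coeff C i xor_) (coeff-≡ (∷-cong refl (*-identityˡ C)) i))))

coeff-compose-subleading : ∀ c {A d} → Deg A (suc d) → coeff (compose A (c+x+x² c)) (suc (d * 2)) ≡ isOdd (suc d)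
coeff-compose-subleading c {a ∷ A} {d} hA = begin
  coeff ([ a ] +ₚ (c+x+x² c *ₚ C)) (suc (d * 2))
    ≡⟨ coeff-[]+ a (c+x+x² c *ₚ C) (d * 2) ⟩
  coeff (c+x+x² c *ₚ C) (suc (d * 2))
    ≡⟨ coeff-c+x+x²* c C (d * 2) ⟩
  (c ∧ coeff C (suc (d * 2))) xor (coeff C (d * 2) xor coeff (false ∷ C) (d * 2))
    ≡⟨ cong₂ (λ above subleading → (c ∧ above) xor (subleading)) (coeff-≥ (below hC) _ ≤-refl)
             (cong₂ _xor_ (leading hC) (subleading-C d (Deg-tail hA))) ⟩
  (c ∧ false) xor isOdd (suc d)
    ≡⟨ cong (_xor isOdd (suc d)) (∧-zeroʳ c) ⟩
  isOdd (suc d)  ∎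
  where
  open ≡-Reasoning
  C = compose A (c+x+x² c)
  hC = Deg-compose (Deg-c+x+x² c) (Deg-tail hA)
  subleading-C : ∀ d → Deg A d → coeff (false ∷ C) (d * 2) ≡ isOdd d
  subleading-C zero    _  = refl
  subleading-C (suc d) hA = coeff-compose-subleading c hA

spread : Poly → Poly
spread []      = []
spread (a ∷ P) = a ∷ false ∷ spread P

evens : Poly → Poly
evens []          = []
evens (a ∷ [])    = a ∷ []
evens (a ∷ b ∷ P) = a ∷ evens P

*-self≋spread : ∀ P → (P *ₚ P) ≋ spread P
*-self≋spread []      = ≋-refl
*-self≋spread (a ∷ P) = begin
  scale a (a ∷ P) +ₚ (false ∷ (P *ₚ (a ∷ P)))
    ≈⟨ +-cong (scale-∷ a a P) (∷-cong refl (*-∷ʳ P a P)) ⟩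
  ((a ∧ a) xor false) ∷ (scale a P +ₚ (scale a P +ₚ (false ∷ (P *ₚ P))))
    ≈⟨ ∷-cong (trans (xor-identityʳ (a ∧ a)) (∧-idem a)) (+-self-cancelˡ (scale a P) _) ⟩
  a ∷ false ∷ (P *ₚ P)
    ≈⟨ ∷-cong refl (∷-cong refl (*-self≋spread P)) ⟩
  a ∷ false ∷ spread P  ∎
  where open ≋-Reasoning

spread-evens : ∀ P → (∀ j → isOdd j ≡ true → coeff P j ≡ false) → spread (evens P) ≋ P
spread-evens []          odd≡0 = ≋-refl
spread-evens (a ∷ [])    odd≡0 = ∷-cong refl false∷0≋0
spread-evens (a ∷ b ∷ P) odd≡0 = ∷-cong refl (∷-cong (sym (odd≡0 1 refl))
  (spread-evens P λ j odd → odd≡0 (suc (suc j)) (trans (not-involutive (isOdd j)) odd)))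

-- The trace form of 𝔽₂[x]/(Q)

module Trace {Q : Poly} {k : ℕ} (hQ : Deg Q (suc k)) where

  open Reduction hQ

  l : ℕ
  l = suc k

  rem : Poly → Poly
  rem = reduce Q l

  -- The trace of multiplication by S on 𝔽₂[x]/(Q), computed in the basis 1, x, …, x^k.
  Tr : Poly → Bool
  Tr S = xorSum l (λ i → coeff (rem (shift i S)) i)

  Tr-cong : ∀ {S S'} → S ≡ S' mod Q → Tr S ≡ Tr S'
  Tr-cong S≡S' = xorSum-cong l λ i _ → coeff-≡ (reduce-cong (shift-≡mod i S≡S')) i

  Tr-+ : ∀ S S' → Tr (S +ₚ S') ≡ Tr S xor Tr S'
  Tr-+ S S' = trans (xorSum-cong l λ i _ → trans (coeff-≡ (rem-shift-+ i) i) (coeff-+ (rem (shift i S)) _ i))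
                    (xorSum-xor l (λ i → coeff (rem (shift i S)) i) (λ i → coeff (rem (shift i S')) i))
    where
    rem-shift-+ : ∀ i → rem (shift i (S +ₚ S')) ≋ (rem (shift i S) +ₚ rem (shift i S'))
    rem-shift-+ i = ≋-trans (reduce-cong (≋⇒≡mod (shift-+ i S S'))) (reduce-+ (shift i S) (shift i S'))

  Tr-0 : Tr 0ₚ ≡ false
  Tr-0 = trans (Tr-+ 0ₚ 0ₚ) (xor-same (Tr 0ₚ))

  Tr-scale : ∀ a S → Tr (scale a S) ≡ a ∧ Tr S
  Tr-scale true  S = refl
  Tr-scale false S = Tr-0

  rem-polySum : ∀ n h → rem (polySum n h) ≋ polySum n (λ j → rem (h j))
  rem-polySum zero    h = ≋-refl
  rem-polySum (suc n) h = ≋-trans (reduce-+ (h 0) _) (+-cong ≋-refl (rem-polySum n _))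

  rem-scale : ∀ a P → rem (scale a P) ≋ scale a (rem P)
  rem-scale true  P = ≋-refl
  rem-scale false P = ≋-refl

  coeff-rem-* : ∀ S T i → DegBelow T l →
                coeff (rem (S *ₚ T)) i ≡ xorSum l (λ j → coeff T j ∧ coeff (rem (shift j S)) i)
  coeff-rem-* S T i bT = begin
    coeff (rem (S *ₚ T)) i
      ≡⟨ coeff-≡ (reduce-cong (≋⇒≡mod (*-as-polySum l S T bT))) i ⟩
    coeff (rem (polySum l (λ j → scale (coeff T j) (shift j S)))) i
      ≡⟨ coeff-≡ (rem-polySum l (λ j → scale (coeff T j) (shift j S))) i ⟩
    coeff (polySum l (λ j → rem (scale (coeff T j) (shift j S)))) i
      ≡⟨ coeff-polySum l (λ j → rem (scale (coeff T j) (shift j S))) i ⟩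
    xorSum l (λ j → coeff (rem (scale (coeff T j) (shift j S))) i)
      ≡⟨ xorSum-cong l (λ j _ → trans (coeff-≡ (rem-scale (coeff T j) (shift j S)) i) (coeff-scale (coeff T j) _ i)) ⟩
    xorSum l (λ j → coeff T j ∧ coeff (rem (shift j S)) i)  ∎
    where open ≡-Reasoning

  -- Over 𝔽₂ the trace of the square of a matrix M is Σᵢⱼ Mᵢⱼ Mⱼᵢ = Σᵢ Mᵢᵢ, the off-diagonal terms pairing off.
  Tr-square : ∀ S → Tr (S *ₚ S) ≡ Tr S
  Tr-square S = begin
    xorSum l (λ i → coeff (rem (shift i (S *ₚ S))) i)
      ≡⟨ xorSum-cong l (λ i _ → entry i) ⟩
    xorSum l (λ i → xorSum l (λ j → M i j ∧ M j i))
      ≡⟨ xorSum-diagonal l (λ i j → M i j ∧ M j i) (λ i j → ∧-comm (M i j) (M j i)) ⟩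
    xorSum l (λ i → M i i ∧ M i i)
      ≡⟨ xorSum-cong l (λ i _ → ∧-idem (M i i)) ⟩
    Tr S  ∎
    where
    open ≡-Reasoning
    M : ℕ → ℕ → Bool
    M j i = coeff (rem (shift j S)) i
    entry : ∀ i → coeff (rem (shift i (S *ₚ S))) i ≡ xorSum l (λ j → M i j ∧ M j i)
    entry i = trans (coeff-≡ (reduce-cong xⁱSS≡S·remxⁱS) i)
                    (coeff-rem-* S (rem (shift i S)) i (reduce-DegBelow (shift i S)))
      where
      xⁱSS≡S·remxⁱS : shift i (S *ₚ S) ≡ S *ₚ rem (shift i S) mod Q
      xⁱSS≡S·remxⁱS = ≡mod-trans (≋⇒≡mod (≋-sym (shift-*ʳ i S S)))
                                 (≡mod-* (≡mod-refl {A = S}) (≡mod-reduce (shift i S)))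

  Tr-X : Tr X ≡ coeff Q k
  Tr-X = trans (xorSum-last k _ below-k) at-k
    where
    below-k : ∀ i → i < k → coeff (rem (shift i X)) i ≡ false
    below-k i i<k = begin
      coeff (rem (shift i X)) i       ≡⟨ cong (λ P → coeff (rem P) i) (shift-∷0 i 1ₚ) ⟩
      coeff (rem (x^ suc i)) i        ≡⟨ coeff-≡ (reduce-id (DegBelow-mono (s≤s i<k) (below (Deg-x^ (suc i))))) i ⟩
      coeff (x^ suc i) i              ≡⟨ coeff-x^ (suc i) i ⟩
      (suc i ≡ᵇ i)                    ≡⟨ ≢⇒≡ᵇ≡false (1+n≢n {i}) ⟩
      false                           ∎
      where open ≡-Reasoning
    at-k : coeff (rem (shift k X)) k ≡ coeff Q k
    at-k = begin
      coeff (rem (shift k X)) k       ≡⟨ cong (λ P → coeff (rem P) k) (shift-∷0 k 1ₚ) ⟩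
      coeff (rem (x^ l)) k            ≡⟨ coeff-≡ rem-xˡ k ⟩
      coeff (x^ l +ₚ Q) k             ≡⟨ coeff-+ (x^ l) Q k ⟩
      coeff (x^ l) k xor coeff Q k    ≡⟨ cong (_xor coeff Q k) (trans (coeff-x^ l k) (≢⇒≡ᵇ≡false (1+n≢n {k}))) ⟩
      coeff Q k                       ∎
      where
      open ≡-Reasoning
      rem-xˡ : rem (x^ l) ≋ (x^ l +ₚ Q)
      rem-xˡ = reduced-≡mod⇒≋ (reduce-DegBelow (x^ l)) (Deg-+-Deg (Deg-x^ l) hQ)
                 (≡mod-trans (≡mod-sym (≡mod-reduce (x^ l))) (≡mod-+-divisible ∣ʳ-refl))

  Tr-const : ∀ c → Tr [ c ] ≡ c ∧ isOdd l
  Tr-const c = trans (xorSum-cong l λ i i<l → trans (coeff-≡ (reduce-id (reduced i<l)) i) (coeff-shift-self i [ c ]))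
                     (xorSum-const l c)
    where
    reduced : ∀ {i} → i < l → DegBelow (shift i [ c ]) l
    reduced {i} i<l = DegBelow-mono i<l (DegBelow-shift-const i)

  τ : Poly → Bool
  τ S = coeff (rem S) k

  τ-cong : ∀ {S S'} → S ≡ S' mod Q → τ S ≡ τ S'
  τ-cong S≡S' = coeff-≡ (reduce-cong S≡S') k

  τ-reduced : ∀ {P} → DegBelow P l → τ P ≡ coeff P k
  τ-reduced bP = coeff-≡ (reduce-id bP) k

  τ-polySum : ∀ n h → τ (polySum n h) ≡ xorSum n (λ j → τ (h j))
  τ-polySum n h = trans (coeff-≡ (rem-polySum n h) k) (coeff-polySum n (λ j → rem (h j)) k)

  quot : ℕ → Poly
  quot i = drop (suc i) Q

  Deg-quot : ∀ {i} → i ≤ k → Deg (quot i) (k ∸ i)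
  Deg-quot {i} i≤k = Deg-drop (suc i) (subst (λ n → Deg Q (suc n)) (sym (m+[n∸m]≡n i≤k)) hQ)

  shift-quot≡take : ∀ i → shift (suc i) (quot i) ≡ take (suc i) Q mod Q
  shift-quot≡take i =
    mod-intro (∣ʳ-respʳ-≈ (≋-trans (≋take+shift-drop (suc i) Q) (+-comm (take (suc i) Q) _)) ∣ʳ-refl)

  τ-shift-quot-above : ∀ {i j} → i < j → j ≤ k → τ (shift j (quot i)) ≡ false
  τ-shift-quot-above {i} {j} i<j j≤k = begin
    τ (shift j (quot i))                       ≡⟨ cong (λ n → τ (shift n (quot i))) (sym t+1+i≡j) ⟩
    τ (shift (t + suc i) (quot i))             ≡⟨ cong τ (shift-shift t (suc i) (quot i)) ⟩
    τ (shift t (shift (suc i) (quot i)))       ≡⟨ τ-cong (shift-≡mod t (shift-quot≡take i)) ⟩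
    τ (shift t (take (suc i) Q))               ≡⟨ τ-reduced (DegBelow-mono (≤-trans t+1+i≤k (n≤1+n k)) low) ⟩
    coeff (shift t (take (suc i) Q)) k         ≡⟨ coeff-≥ low k t+1+i≤k ⟩
    false                                      ∎
    where
    open ≡-Reasoning
    t = j ∸ suc i
    t+1+i≡j : t + suc i ≡ j
    t+1+i≡j = m∸n+n≡m i<j
    t+1+i≤k : t + suc i ≤ k
    t+1+i≤k = subst (_≤ k) (sym t+1+i≡j) j≤k
    low : DegBelow (shift t (take (suc i) Q)) (t + suc i)
    low = DegBelow-shift t (DegBelow-take (suc i) Q)

  τ-dual : ∀ {i j} → i ≤ k → j ≤ k → τ (shift j (quot i)) ≡ (j ≡ᵇ i)
  τ-dual {i} {j} i≤k j≤k with <-cmp j i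
  ... | tri< j<i _ _ = begin
    τ (shift j (quot i))          ≡⟨ τ-reduced (DegBelow-mono (s≤s (<⇒≤ j+s<k)) (below hP)) ⟩
    coeff (shift j (quot i)) k    ≡⟨ coeff-≥ (below hP) k j+s<k ⟩
    false                         ≡⟨ ≢⇒≡ᵇ≡false (<⇒≢ j<i) ⟨
    (j ≡ᵇ i)                      ∎
    where
    open ≡-Reasoning
    hP = Deg-shift j (Deg-quot i≤k)
    j+s<k : j + (k ∸ i) < k
    j+s<k = subst (j + (k ∸ i) <_) (m+[n∸m]≡n i≤k) (+-monoˡ-< (k ∸ i) j<i)
  ... | tri≈ _ refl _ = begin
    τ (shift i (quot i))          ≡⟨ τ-reduced (subst (λ n → DegBelow (shift i (quot i)) (suc n)) i+s≡k (below hP)) ⟩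
    coeff (shift i (quot i)) k    ≡⟨ subst (λ n → coeff (shift i (quot i)) n ≡ true) i+s≡k (leading hP) ⟩
    true                          ≡⟨ ≡ᵇ-refl i ⟨
    (i ≡ᵇ i)                      ∎
    where
    open ≡-Reasoning
    hP = Deg-shift i (Deg-quot i≤k)
    i+s≡k = m+[n∸m]≡n i≤k
  ... | tri> _ _ i<j = trans (τ-shift-quot-above i<j j≤k) (sym (≢⇒≡ᵇ≡false (λ j≡i → <⇒≢ i<j (sym j≡i))))

  -- The polynomials quot i form the basis dual to 1, x, …, x^k under (S, T) ↦ τ (S T).
  coeff-rem≡τ : ∀ T {i} → i ≤ k → coeff (rem T) i ≡ τ (T *ₚ quot i)
  coeff-rem≡τ T {i} i≤k = sym (begin
    τ (T *ₚ quot i)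
      ≡⟨ τ-cong (≡mod-trans (≡mod-* (≡mod-reduce T) (≡mod-refl {A = quot i})) (≋⇒≡mod (*-comm (rem T) (quot i)))) ⟩
    τ (quot i *ₚ rem T)
      ≡⟨ coeff-rem-* (quot i) (rem T) k (reduce-DegBelow T) ⟩
    xorSum l (λ j → coeff (rem T) j ∧ τ (shift j (quot i)))
      ≡⟨ xorSum-cong l (λ j j<l → cong (coeff (rem T) j ∧_) (τ-dual i≤k (≤-pred j<l))) ⟩
    xorSum l (λ j → coeff (rem T) j ∧ (j ≡ᵇ i))
      ≡⟨ xorSum-δ l (coeff (rem T)) i (s≤s i≤k) ⟩
    coeff (rem T) i  ∎)
    where open ≡-Reasoning

  -- W is the formal derivative of Q (see coeff-W), so Tr-as-τ is Euler's formula Tr S = τ (S Q').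
  W : Poly
  W = polySum l (λ i → shift i (quot i))

  Tr-as-τ : ∀ S → Tr S ≡ τ (S *ₚ W)
  Tr-as-τ S = begin
    xorSum l (λ i → coeff (rem (shift i S)) i)
      ≡⟨ xorSum-cong l (λ i i<l → coeff-rem≡τ (shift i S) (≤-pred i<l)) ⟩
    xorSum l (λ i → τ (shift i S *ₚ quot i))
      ≡⟨ xorSum-cong l (λ i _ → τ-cong (≋⇒≡mod (≋-trans (shift-*ˡ i S (quot i)) (≋-sym (shift-*ʳ i S (quot i)))))) ⟩
    xorSum l (λ i → τ (S *ₚ shift i (quot i)))
      ≡⟨ τ-polySum l (λ i → S *ₚ shift i (quot i)) ⟨
    τ (polySum l (λ i → S *ₚ shift i (quot i)))
      ≡⟨ τ-cong (≋⇒≡mod (*-polySum S l (λ i → shift i (quot i)))) ⟨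
    τ (S *ₚ W)  ∎
    where open ≡-Reasoning

  coeff-W : ∀ m → coeff W m ≡ coeff Q (suc m) ∧ xorSum l (λ i → leq i m)
  coeff-W m = begin
    coeff W m
      ≡⟨ coeff-polySum l (λ i → shift i (quot i)) m ⟩
    xorSum l (λ i → coeff (shift i (quot i)) m)
      ≡⟨ xorSum-cong l (λ i _ → trans (coeff-shift-drop i Q m) (∧-comm (leq i m) _)) ⟩
    xorSum l (λ i → coeff Q (suc m) ∧ leq i m)
      ≡⟨ xorSum-∧ l (coeff Q (suc m)) (λ i → leq i m) ⟩
    coeff Q (suc m) ∧ xorSum l (λ i → leq i m)  ∎
    where open ≡-Reasoning

  DegBelow-W : DegBelow W l
  DegBelow-W = degBelow λ m l≤m → trans (coeff-W m) (cong (_∧ _) (coeff-≥ (below hQ) (suc m) (s≤s l≤m)))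

  W≋0⇒odd-coeffs-vanish : W ≋ 0ₚ → ∀ j → isOdd j ≡ true → coeff Q j ≡ false
  W≋0⇒odd-coeffs-vanish W≋0 (suc m) odd with <-cmp m l
  ... | tri< m<l _ _ = begin
    coeff Q (suc m)                                    ≡⟨ ∧-identityʳ _ ⟨
    coeff Q (suc m) ∧ true                             ≡⟨ cong (coeff Q (suc m) ∧_) (trans (xorSum-leq l m m<l) odd) ⟨
    coeff Q (suc m) ∧ xorSum l (λ i → leq i m)         ≡⟨ coeff-W m ⟨
    coeff W m                                          ≡⟨ coeff-≡ W≋0 m ⟩
    false                                              ∎
    where open ≡-Reasoning
  ... | tri≈ _ refl _ = coeff-≥ (below hQ) (suc m) ≤-refl
  ... | tri> _ _ l<m  = coeff-≥ (below hQ) (suc m) (≤-trans l<m (n≤1+n m))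

  trace-one : Irreducible Q → ∃[ b ] Tr b ≡ true
  trace-one irr with irreducible⇒divides-or-invertible irr W
  ... | inj₁ Q∣W = ⊥-elim (irreducible⇒¬square {R = evens Q} irr Q≋square)
    where
    Q≋square : Q ≋ (evens Q *ₚ evens Q)
    Q≋square = ≋-sym (≋-trans (*-self≋spread (evens Q))
                 (spread-evens Q (W≋0⇒odd-coeffs-vanish (DegBelow-∣⇒≋0 hQ DegBelow-W Q∣W))))
  ... | inj₂ (C , WC≡1) = (x^ k *ₚ C) , (begin
    Tr (x^ k *ₚ C)                 ≡⟨ Tr-as-τ (x^ k *ₚ C) ⟩
    τ ((x^ k *ₚ C) *ₚ W)           ≡⟨ τ-cong xᵏCW≡xᵏ ⟩
    τ (x^ k)                       ≡⟨ τ-reduced (below (Deg-x^ k)) ⟩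
    coeff (x^ k) k                 ≡⟨ trans (coeff-x^ k k) (≡ᵇ-refl k) ⟩
    true                           ∎)
    where
    open ≡-Reasoning
    xᵏCW≡xᵏ : ((x^ k *ₚ C) *ₚ W) ≡ x^ k mod Q
    xᵏCW≡xᵏ = ≡mod-trans (≋⇒≡mod (≋-trans (*-assoc (x^ k) C W) (*-congˡ (x^ k) (*-comm C W))))
                (≡mod-trans (≡mod-* (≡mod-refl {A = x^ k}) WC≡1) (≋⇒≡mod (*-identityʳ (x^ k))))

-- The factors of Q(c + x + x²)

*2≡+ : ∀ n → n * 2 ≡ n + n
*2≡+ n = trans (*-suc n 1) (cong (n +_) (ℕ.*-identityʳ n))

both-halves : ∀ {l a b} → l ≤ a → l ≤ b → a + b ≡ l + l → a ≡ l
both-halves {l} {a} l≤a l≤b a+b≡l+l with <-cmp l a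
... | tri< l<a _ _ = contradiction (subst (l + l <_) a+b≡l+l (+-mono-<-≤ l<a l≤b)) (<-irrefl refl)
... | tri≈ _ l≡a _ = sym l≡a
... | tri> _ _ a<l = contradiction l≤a (<⇒≱ a<l)

FactorsTwo-map : ∀ l P {R R'} → (∀ a b → R a b → R' a b) → FactorsTwo l P R → FactorsTwo l P R'
FactorsTwo-map l P f (F , G , iF , iG , hF , hG , e , r) = F , G , iF , iG , hF , hG , e , f (trace l F) (trace l G) r

module Substitution {Q : Poly} {k : ℕ} (hQ : Deg Q (suc k)) (irr : Irreducible Q) (c : Bool) where

  open Reduction hQ
  open Trace hQ

  u : Poly
  u = c+x+x² c

  P : Poly
  P = compose Q u

  Deg-P : Deg P (l * 2)
  Deg-P = Deg-compose (Deg-c+x+x² c) hQ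

  θ : Poly
  θ = X +ₚ [ c ]

  Tr-θ : Tr θ ≡ coeff Q k xor (c ∧ isOdd l)
  Tr-θ = trans (Tr-+ X [ c ]) (cong₂ _xor_ Tr-X (Tr-const c))

  artinSchreier : Poly → Poly
  artinSchreier Y = ((Y *ₚ Y) +ₚ Y) +ₚ θ

  Tr-artinSchreier : ∀ Y → Tr (artinSchreier Y) ≡ Tr θ
  Tr-artinSchreier Y = begin
    Tr (((Y *ₚ Y) +ₚ Y) +ₚ θ)           ≡⟨ trans (Tr-+ ((Y *ₚ Y) +ₚ Y) θ) (cong (_xor Tr θ) (Tr-+ (Y *ₚ Y) Y)) ⟩
    (Tr (Y *ₚ Y) xor Tr Y) xor Tr θ     ≡⟨ cong (λ t → (t xor Tr Y) xor Tr θ) (Tr-square Y) ⟩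
    (Tr Y xor Tr Y) xor Tr θ            ≡⟨ cong (_xor Tr θ) (xor-same (Tr Y)) ⟩
    Tr θ                                ∎
    where open ≡-Reasoning

  compose-θ : compose θ u ≋ ((X *ₚ X) +ₚ X)
  compose-θ = ≋-trans (compose-+ X [ c ] u) (≋-trans (+-cong (compose-X u) (compose-const c u))
                (mk≋ λ { zero → xor-same c ; (suc zero) → refl ; (suc (suc _)) → refl }))

  compose-artinSchreier : ∀ Y → let Yu = compose Y u in
    compose (artinSchreier Y) u ≋ (((Yu *ₚ Yu) +ₚ Yu) +ₚ ((X *ₚ X) +ₚ X))
  compose-artinSchreier Y = ≋-trans (compose-+ ((Y *ₚ Y) +ₚ Y) θ u) (+-cong
    (≋-trans (compose-+ (Y *ₚ Y) Y u) (+-cong (compose-* Y Y u) ≋-refl)) compose-θ)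

  compose-reflects-zero : ∀ {A} → A ∣ P → ¬ IsUnit A → ∀ S → compose S u ≡ 0ₚ mod A → Q ∣ S
  compose-reflects-zero {A} A∣P nonunit S Su≡0 with irreducible⇒divides-or-invertible irr S
  ... | inj₁ Q∣S       = Q∣S
  ... | inj₂ (C , SC≡1) = contradiction (∣1⇒IsUnit (≡mod0⇒∣ 1≡0)) nonunit
    where
    1≡0 : 1ₚ ≡ 0ₚ mod A
    1≡0 = begin
      1ₚ                            ≈⟨ ≋⇒≡mod (compose-const true u) ⟨
      compose 1ₚ u                  ≈⟨ ≡mod-weaken A∣P (compose-≡mod u SC≡1) ⟨
      compose (S *ₚ C) u            ≈⟨ ≋⇒≡mod (compose-* S C u) ⟩
      compose S u *ₚ compose C u    ≈⟨ ≡mod-* Su≡0 (≡mod-refl {A = compose C u}) ⟩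
      0ₚ                            ∎
      where open ≡mod-Reasoning A

  embedding : ∀ {A a} → Deg A a → A ∣ P → ¬ IsUnit A → BoundedInjection l a
  embedding {A} {a} hA A∣P nonunit = record
    { map       = λ S → reduce A a (compose S u)
    ; map-below = λ S → Reduction.reduce-DegBelow hA (compose S u)
    ; injective = λ {S} {S'} bS bS' e → sum≋0⇒≋ (DegBelow-∣⇒≋0 hQ (DegBelow-+ bS bS')
        (compose-reflects-zero A∣P nonunit (S +ₚ S') (≡mod-trans (≋⇒≡mod (compose-+ S S' u)) (sum≡0 S S' e))))
    }
    where
    sum≡0 : ∀ S S' → reduce A a (compose S u) ≋ reduce A a (compose S' u) → (compose S u +ₚ compose S' u) ≡ 0ₚ mod A
    sum≡0 S S' e = ∣⇒≡mod0 (divides (Reduction.reduce-≋⇒≡mod hA {compose S u} {compose S' u} e))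

  divisor-degree : ∀ {A a} → Deg A a → A ∣ P → ¬ IsUnit A → l ≤ a
  divisor-degree hA A∣P nonunit = BoundedInjection.dimension-≤ (embedding hA A∣P nonunit)

  degree-l-factor⇒root : ∀ {A} → Deg A l → A ∣ P → ¬ IsUnit A → ∃[ Y ] Q ∣ artinSchreier Y
  degree-l-factor⇒root {A} hA A∣P nonunit = root (surjective ι (reduce A l X) (RA.reduce-DegBelow X))
    where
    module RA = Reduction hA
    ι = embedding hA A∣P nonunit
    root : ∃[ Y ] (DegBelow Y l × BoundedInjection.map ι Y ≋ reduce A l X) → ∃[ Y ] Q ∣ artinSchreier Y
    root (Y , _ , Yu≋x) = Y , compose-reflects-zero A∣P nonunit (artinSchreier Y) (begin
      compose (artinSchreier Y) u                ≈⟨ ≋⇒≡mod (compose-artinSchreier Y) ⟩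
      ((Yu *ₚ Yu) +ₚ Yu) +ₚ x²+x                 ≈⟨ ≡mod-+ (≡mod-+ (≡mod-* Yu≡x Yu≡x) Yu≡x) (≡mod-refl {A = x²+x}) ⟩
      x²+x +ₚ x²+x                               ≈⟨ ≋⇒≡mod (+-self x²+x) ⟩
      0ₚ                                         ∎)
      where
      open ≡mod-Reasoning A
      x²+x = (X *ₚ X) +ₚ X
      Yu = compose Y u
      Yu≡x : Yu ≡ X mod A
      Yu≡x = RA.reduce-≋⇒≡mod {Yu} {X} Yu≋x

  balanced : ∀ {F G} → ¬ IsUnit F → ¬ IsUnit G → P ≋ (F *ₚ G) → Deg F l × Deg G l
  balanced {F} {G} F-nonunit G-nonunit P≋FG =
    halves (nonunit⇒positive-degree (x∣y∧y≉0⇒x≉0 F∣P P≉0) F-nonunit)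
           (nonunit⇒positive-degree (x∣y∧y≉0⇒x≉0 G∣P P≉0) G-nonunit)
    where
    P≉0 = Deg⇒≉0 Deg-P
    F∣P = proj₁ (xy≈z⇒x|z∧y|z F G (≋-sym P≋FG))
    G∣P = proj₂ (xy≈z⇒x|z∧y|z F G (≋-sym P≋FG))
    halves : ∃[ f ] Deg F (suc f) → ∃[ g ] Deg G (suc g) → Deg F l × Deg G l
    halves (f , hF) (g , hG) = subst (Deg F) (both-halves l≤f l≤g f+g≡l+l) hF
                             , subst (Deg G) (both-halves l≤g l≤f (trans (ℕ.+-comm (suc g) (suc f)) f+g≡l+l)) hG
      where
      l≤f = divisor-degree hF F∣P F-nonunit
      l≤g = divisor-degree hG G∣P G-nonunit
      f+g≡l+l : suc f + suc g ≡ l + l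
      f+g≡l+l = trans (Deg-unique (Deg-* hF hG) (Deg-resp-≋ P≋FG Deg-P)) (*2≡+ l)

  irreducible-if-trace-one : Tr θ ≡ true → Irreducible P
  irreducible-if-trace-one Trθ≡1 = irreducible-by-degree Deg-P no-split
    where
    no-root : ∃[ Y ] Q ∣ artinSchreier Y → ⊥
    no-root (Y , Q∣ASY) = ≡false⇒≢true (trans (sym (Tr-artinSchreier Y)) (trans (Tr-cong (∣⇒≡mod0 Q∣ASY)) Tr-0)) Trθ≡1
    no-split : ∀ {A B a b} → Deg A (suc a) → Deg B (suc b) → P ≋ (A *ₚ B) → ⊥
    no-split {A} {B} hA hB P≋AB = no-root (degree-l-factor⇒root (proj₁ (balanced A-nonunit B-nonunit P≋AB))
                                                                (proj₁ (xy≈z⇒x|z∧y|z A B (≋-sym P≋AB))) A-nonunit)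
      where
      A-nonunit = positive-degree⇒nonunit hA
      B-nonunit = positive-degree⇒nonunit hB

  degree-l-factor-irreducible : ∀ {F} → Deg F l → F ∣ P → Irreducible F
  degree-l-factor-irreducible {F} hF F∣P = irreducible-by-degree hF no-split
    where
    no-split : ∀ {A B a b} → Deg A (suc a) → Deg B (suc b) → F ≋ (A *ₚ B) → ⊥
    no-split {A} {B} {a} hA hB F≋AB = contradiction (divisor-degree hA A∣P (positive-degree⇒nonunit hA)) (<⇒≱ a<l)
      where
      A∣P = ∣ʳ-trans (proj₁ (xy≈z⇒x|z∧y|z A B (≋-sym F≋AB))) F∣P
      a<l : suc a < l
      a<l = subst (suc a <_) (Deg-unique (Deg-* hA hB) (Deg-resp-≋ F≋AB hF)) (m<m+n (suc a) (s≤s z≤n))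

  trace-sum : ∀ {F G} → Deg F l → Deg G l → P ≋ (F *ₚ G) → (coeff F k xor coeff G k) ≡ isOdd l
  trace-sum {F} {G} hF hG P≋FG = begin
    coeff F k xor coeff G k      ≡⟨ coeff-*-subleading hF hG ⟨
    coeff (F *ₚ G) (suc (k + k)) ≡⟨ coeff-≡ P≋FG _ ⟨
    coeff P (suc (k + k))        ≡⟨ cong (λ n → coeff P (suc n)) (*2≡+ k) ⟨
    coeff P (suc (k * 2))        ≡⟨ coeff-compose-subleading c hQ ⟩
    isOdd l                      ∎
    where open ≡-Reasoning

  module ArtinSchreier (b : Poly) (Trb≡1 : Tr b ≡ true) where

    F : Poly → Poly
    F V = ((V *ₚ V) +ₚ V) +ₚ scale (coeff V 0) b

    Tr-F : ∀ V → Tr (F V) ≡ coeff V 0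
    Tr-F V = begin
      Tr (((V *ₚ V) +ₚ V) +ₚ scale (coeff V 0) b)
        ≡⟨ Tr-+ ((V *ₚ V) +ₚ V) _ ⟩
      Tr ((V *ₚ V) +ₚ V) xor Tr (scale (coeff V 0) b)
        ≡⟨ cong₂ _xor_ (trans (Tr-+ (V *ₚ V) V) (cong (_xor Tr V) (Tr-square V))) (Tr-scale (coeff V 0) b) ⟩
      (Tr V xor Tr V) xor (coeff V 0 ∧ Tr b)
        ≡⟨ cong₂ _xor_ (xor-same (Tr V)) (trans (cong (coeff V 0 ∧_) Trb≡1) (∧-identityʳ _)) ⟩
      coeff V 0  ∎
      where open ≡-Reasoning

    F-+ : ∀ V W → (F V +ₚ F W) ≋ F (V +ₚ W)
    F-+ V W = begin
      F V +ₚ F W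
        ≈⟨ +-middleFour ((V *ₚ V) +ₚ V) (scale (coeff V 0) b) ((W *ₚ W) +ₚ W) (scale (coeff W 0) b) ⟩
      (((V *ₚ V) +ₚ V) +ₚ ((W *ₚ W) +ₚ W)) +ₚ (scale (coeff V 0) b +ₚ scale (coeff W 0) b)
        ≈⟨ +-cong (≋-trans (+-middleFour (V *ₚ V) V (W *ₚ W) W) (+-cong (≋-sym (square-+ V W)) ≋-refl))
                  (≋-trans (≋-sym (scale-xor (coeff V 0) (coeff W 0) b)) (scale-congʳ b (sym (coeff-+ V W 0)))) ⟩
      F (V +ₚ W)  ∎
      where open ≋-Reasoning

    F-kernel : ∀ {S} → DegBelow S l → F S ≡ 0ₚ mod Q → S ≋ 0ₚ
    F-kernel {S} bS FS≡0 =
      [ DegBelow-∣⇒≋0 hQ bS , (λ Q∣S+1 → contradiction (DegBelow-∣⇒≋0 hQ S+1-below Q∣S+1) S+1≉0) ]′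
      (irreducible⇒prime irr S (S +ₚ 1ₚ) (≡mod0⇒∣ (≡mod-trans (≋⇒≡mod (≋-sym FS≋S[S+1])) FS≡0)))
      where
      S₀≡0 : coeff S 0 ≡ false
      S₀≡0 = trans (sym (Tr-F S)) (trans (Tr-cong FS≡0) Tr-0)
      FS≋S[S+1] : F S ≋ (S *ₚ (S +ₚ 1ₚ))
      FS≋S[S+1] = ≋-trans (+-cong ≋-refl (scale-congʳ b S₀≡0)) (≋-trans (+-identityʳ _)
                    (≋-sym (≋-trans (*-distribˡ S S 1ₚ) (+-cong ≋-refl (*-identityʳ S)))))
      S+1-below : DegBelow (S +ₚ 1ₚ) l
      S+1-below = DegBelow-+ bS DegBelow-const
      S+1≉0 : ¬ ((S +ₚ 1ₚ) ≋ 0ₚ)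
      S+1≉0 S+1≋0 = ≡false⇒≢true (coeff-≡ S+1≋0 0) (trans (coeff-+ S 1ₚ 0) (cong (_xor true) S₀≡0))

    injection : BoundedInjection l l
    injection = record
      { map       = λ V → rem (F V)
      ; map-below = λ V → reduce-DegBelow (F V)
      ; injective = λ {V} {W} bV bW e → sum≋0⇒≋ (F-kernel (DegBelow-+ bV bW)
          (≡mod-trans (≋⇒≡mod (≋-sym (F-+ V W))) (∣⇒≡mod0 (divides (reduce-≋⇒≡mod {F V} {F W} e)))))
      }

    solution : Tr θ ≡ false → ∃[ Y ] (DegBelow Y l × Q ∣ artinSchreier Y)
    solution Trθ≡0 = solve (surjective injection (rem θ) (reduce-DegBelow θ))
      where
      solve : ∃[ Y ] (DegBelow Y l × rem (F Y) ≋ rem θ) → ∃[ Y ] (DegBelow Y l × Q ∣ artinSchreier Y)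
      solve (Y , bY , FY≋θ) = Y , bY , divides (≡mod-trans (≋⇒≡mod (≋-sym FY≋Y²+Y)) FY≡θ)
        where
        FY≡θ : F Y ≡ θ mod Q
        FY≡θ = reduce-≋⇒≡mod {F Y} {θ} FY≋θ
        Y₀≡0 : coeff Y 0 ≡ false
        Y₀≡0 = trans (sym (Tr-F Y)) (trans (Tr-cong FY≡θ) Trθ≡0)
        FY≋Y²+Y : F Y ≋ ((Y *ₚ Y) +ₚ Y)
        FY≋Y²+Y = ≋-trans (+-cong ≋-refl (scale-congʳ b Y₀≡0)) (+-identityʳ _)

  X≉compose : ∀ Z → ¬ (X ≋ compose Z u)
  X≉compose Z X≋Zu with zero-or-Deg Z
  ... | inj₁ Z≋0      = Deg⇒≉0 Deg-X (≋-trans X≋Zu (compose-≋0 u Z≋0))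
  ... | inj₂ (z , hZ) = 1≢*2 z (Deg-unique Deg-X (Deg-resp-≋ (≋-sym X≋Zu) (Deg-compose (Deg-c+x+x² c) hZ)))
    where
    1≢*2 : ∀ z → 1 ≢ z * 2
    1≢*2 zero    ()
    1≢*2 (suc z) ()

  P∤x+compose : ∀ Z → DegBelow Z l → ¬ (P ∣ (X +ₚ compose Z u))
  P∤x+compose Z bZ P∣x+Zu = X≉compose Z (sum≋0⇒≋ (DegBelow-∣⇒≋0 Deg-P (DegBelow-+ x-below Zu-below) P∣x+Zu))
    where
    x-below : DegBelow X (l * 2)
    x-below = DegBelow-mono (s≤s (s≤s z≤n)) (below Deg-X)
    Zu-below : DegBelow (compose Z u) (l * 2)
    Zu-below = DegBelow-mono (n≤1+n _) (DegBelow-compose (Deg-c+x+x² c) bZ)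

  root⇒factorization : ∀ {Y} → DegBelow Y l → Q ∣ artinSchreier Y → ProperFactorization P
  root⇒factorization {Y} bY Q∣ASY = gcd-factorization P∣A[A+1] (P∤x+compose Y bY)
    (λ P∣A+1 → P∤x+compose (Y +ₚ 1ₚ) (DegBelow-+ bY DegBelow-const) (∣ʳ-respʳ-≈ A+1≋x+[Y+1]u P∣A+1))
    where
    Yu = compose Y u
    A = X +ₚ Yu
    expand : ∀ X Yu → ((X +ₚ Yu) *ₚ ((X +ₚ Yu) +ₚ 1ₚ))
                    ≋ ((((Yu *ₚ Yu) +ₚ Yu) +ₚ ((X *ₚ X) +ₚ X)) +ₚ ((X *ₚ Yu) +ₚ (X *ₚ Yu)))
    expand = solve-∀ almostPolyRing
    A[A+1]≋ASYu : (A *ₚ (A +ₚ 1ₚ)) ≋ compose (artinSchreier Y) u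
    A[A+1]≋ASYu = ≋-trans (drop-double (X *ₚ Yu) (expand X Yu)) (≋-sym (compose-artinSchreier Y))
    P∣A[A+1] : P ∣ (A *ₚ (A +ₚ 1ₚ))
    P∣A[A+1] = ∣ʳ-respʳ-≈ (≋-sym A[A+1]≋ASYu) (compose-∣ u Q∣ASY)
    A+1≋x+[Y+1]u : (A +ₚ 1ₚ) ≋ (X +ₚ compose (Y +ₚ 1ₚ) u)
    A+1≋x+[Y+1]u = ≋-trans (+-assoc X Yu 1ₚ) (+-cong ≋-refl
                     (≋-sym (≋-trans (compose-+ Y 1ₚ u) (+-cong (≋-refl {Yu}) (compose-const true u)))))

  factors-if-trace-zero : Tr θ ≡ false → FactorsTwo l P (λ a b → (a xor b) ≡ isOdd l)
  factors-if-trace-zero Trθ≡0 = irreducible-halves (from-root (ArtinSchreier.solution b Trb≡1 Trθ≡0))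
    where
    b = proj₁ (trace-one irr)
    Trb≡1 = proj₂ (trace-one irr)
    from-root : ∃[ Y ] (DegBelow Y l × Q ∣ artinSchreier Y) → ProperFactorization P
    from-root (Y , bY , Q∣ASY) = root⇒factorization bY Q∣ASY
    irreducible-halves : ProperFactorization P → FactorsTwo l P (λ a b → (a xor b) ≡ isOdd l)
    irreducible-halves (F , G , F-nonunit , G-nonunit , P≋FG) =
      F , G , degree-l-factor-irreducible hF F∣P , degree-l-factor-irreducible hG G∣P ,
      Deg⇒HasDegree hF , Deg⇒HasDegree hG , coeff-≡ P≋FG , trace-sum hF hG P≋FG
      where
      hF = proj₁ (balanced {F} {G} F-nonunit G-nonunit P≋FG)
      hG = proj₂ (balanced {F} {G} F-nonunit G-nonunit P≋FG)
      F∣P = proj₁ (xy≈z⇒x|z∧y|z F G (≋-sym P≋FG))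
      G∣P = proj₂ (xy≈z⇒x|z∧y|z F G (≋-sym P≋FG))

substitution-criterion : ∀ {l Q} → HasDegree Q l → Irreducible Q → ∀ c →
  let P = compose Q (c+x+x² c) ; t = trace l Q xor (c ∧ isOdd l) in
  (t ≡ true → Irreducible P × HasDegree P (2 * l)) × (t ≡ false → FactorsTwo l P (λ a b → (a xor b) ≡ isOdd l))
substitution-criterion {zero} {Q} hQ (_ , nonunit , _) c = ⊥-elim (nonunit (Deg0⇒IsUnit (HasDegree⇒Deg {Q} hQ)))
substitution-criterion {suc k} {Q} hQ irr c =
  (λ t≡1 → irreducible-if-trace-one (trans Tr-θ t≡1) , Deg⇒HasDegree (subst (Deg P) (ℕ.*-comm (suc k) 2) Deg-P)) ,
  (λ t≡0 → factors-if-trace-zero (trans Tr-θ t≡0))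
  where open Substitution (HasDegree⇒Deg {Q} hQ) irr c

even-degree : ∀ (m : ℕ) (Q : Poly) → HasDegree Q (2 * m) → Irreducible Q →
  (coeff Q (2 * m ∸ 1) ≡ true →
    (Irreducible (compose Q x+x²) × HasDegree (compose Q x+x²) (2 * (2 * m)))
    × (Irreducible (compose Q 1+x+x²) × HasDegree (compose Q 1+x+x²) (2 * (2 * m))))
  × (coeff Q (2 * m ∸ 1) ≡ false →
    FactorsTwo (2 * m) (compose Q x+x²) _≡_ × FactorsTwo (2 * m) (compose Q 1+x+x²) _≡_)
even-degree m Q hQ irr =
  (λ tr≡1 → proj₁ (criterion false) (t≡tr false tr≡1) , proj₁ (criterion true) (t≡tr true tr≡1)) ,
  (λ tr≡0 → FactorsTwo-map (2 * m) (compose Q x+x²) same-traces (proj₂ (criterion false) (t≡tr false tr≡0)) ,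
            FactorsTwo-map (2 * m) (compose Q 1+x+x²) same-traces (proj₂ (criterion true) (t≡tr true tr≡0)))
  where
  criterion = substitution-criterion {2 * m} {Q} hQ irr
  same-traces : ∀ a b → (a xor b) ≡ isOdd (2 * m) → a ≡ b
  same-traces _ _ a+b≡ = xor≡false⇒≡ (trans a+b≡ (isOdd-even m))
  t≡tr : ∀ c {t} → trace (2 * m) Q ≡ t → (trace (2 * m) Q xor (c ∧ isOdd (2 * m))) ≡ t
  t≡tr c tr≡t = trans (cong (λ o → trace (2 * m) Q xor (c ∧ o)) (isOdd-even m))
                      (trans (cong (trace (2 * m) Q xor_) (∧-zeroʳ c)) (trans (xor-identityʳ _) tr≡t))

odd-degree : ∀ (m : ℕ) (Q : Poly) → HasDegree Q (2 * m + 1) → Irreducible Q →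
  (Irreducible (compose Q (c+x+x² (not (coeff Q (2 * m)))))
    × HasDegree (compose Q (c+x+x² (not (coeff Q (2 * m))))) (2 * (2 * m + 1)))
  × FactorsTwo (2 * m + 1) (compose Q (c+x+x² (coeff Q (2 * m)))) _≢_
odd-degree m Q hQ irr =
  proj₁ (criterion (not α)) (trans (t≡α+c (not α)) (xor-inverseʳ α)) ,
  FactorsTwo-map (2 * m + 1) (compose Q (c+x+x² α)) different-traces
    (proj₂ (criterion α) (trans (t≡α+c α) (xor-same α)))
  where
  α = coeff Q (2 * m)
  criterion = substitution-criterion {2 * m + 1} {Q} hQ irr
  different-traces : ∀ a b → (a xor b) ≡ isOdd (2 * m + 1) → a ≢ b
  different-traces a b a+b≡ = xor≡true⇒≢ {a} {b} (trans a+b≡ (isOdd-odd m))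
  t≡α+c : ∀ c → (trace (2 * m + 1) Q xor (c ∧ isOdd (2 * m + 1))) ≡ α xor c
  t≡α+c c = cong₂ _xor_ (cong (coeff Q) (m+n∸n≡m (2 * m) 1)) (trans (cong (c ∧_) (isOdd-odd m)) (∧-identityʳ c))

theorem2 :
  -- (a) even degree l = 2m
  (∀ (m : ℕ) (Q : Poly) → HasDegree Q (2 * m) → Irreducible Q →
    (coeff Q (2 * m ∸ 1) ≡ true →
      (Irreducible (compose Q x+x²) × HasDegree (compose Q x+x²) (2 * (2 * m)))
      × (Irreducible (compose Q 1+x+x²) × HasDegree (compose Q 1+x+x²) (2 * (2 * m))))
    × (coeff Q (2 * m ∸ 1) ≡ false →
      FactorsTwo (2 * m) (compose Q x+x²) _≡_
      × FactorsTwo (2 * m) (compose Q 1+x+x²) _≡_))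
  ×
  -- (b) odd degree l = 2m+1
  (∀ (m : ℕ) (Q : Poly) → HasDegree Q (2 * m + 1) → Irreducible Q →
    (Irreducible (compose Q (c+x+x² (not (coeff Q (2 * m)))))
      × HasDegree (compose Q (c+x+x² (not (coeff Q (2 * m))))) (2 * (2 * m + 1)))
    × FactorsTwo (2 * m + 1) (compose Q (c+x+x² (coeff Q (2 * m)))) _≢_)
theorem2 = even-degree , odd-degree
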